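{- For any upper left weak bicomposition $\binom{\alpha}{\beta}=\binom{\alpha_1,\dots,\alpha_k}{\beta_1,\dots,\beta_k}$, $$\widehat{M}_{\binom{\alpha}{\beta}}=\sum_{I=(i_1,\dots,i_k)}c_{\beta,I}\,M_{(0^{i_1},\alpha_1,0^{i_2},\alpha_2,\dots,0^{i_k},\alpha_k)},$$ where the sum runs over $I$ with $0\le i_j\le\beta_j+\beta_{j+1}+\dots+\beta_k$ for $j=1,\dots,k$.
   Context: An upper left weak bicomposition is a pair of weak compositions (sequences of nonnegative integers) $\alpha,\beta$ of the same length $k$ with $\alpha_k>0$. With $X=\{x_1,x_2,\dots\}$, $\widehat{M}_{\binom{\alpha}{\beta}}=\sum_{0<i_1<\dots<i_k}i_1^{\beta_1}\cdots i_k^{\beta_k}x_{i_1}^{\alpha_1}\cdots x_{i_k}^{\alpha_k}$ ($i^0=1$), and for a left weak composition $\gamma$ (last entry positive) $M_\gamma=\sum_{0<i_1<\dots<i_m}x_{i_1}^{\gamma_1}\cdots x_{i_m}^{\gamma_m}$; $0^i$ denotes $i$ consecutive zeros. Definition of $c_{\beta,I}$: take positive integers $n_1<\dots<n_k$, $n_0=0$, $b_j=\beta_1+\dots+\beta_j$, symbols $u_1,\dots,u_k$; a filtered pointed map is $\bar f:\{1,\dots,b_k\}\cup\{u_1,\dots,u_k\}\to\{1,\dots,n_k\}$ with $\bar f(\{1,\dots,b_j\})\subseteq\{1,\dots,n_j\}$ and $\bar f(u_j)=n_j$; $c_{\beta,I}$ is the number of filtered pointed maps whose image meets $\{n_{j-1}+1,\dots,n_j-1\}$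 exactly in a fixed subset $Y_j$ of size $i_j$, for all $j$ (this depends only on $\beta$ and $I$, and is $0$ if no such map exists); convention $c_{0^k,I}=1$. -}

module Defs where

open import Data.Nat using (ℕ; zero; suc; _+_; _*_; _∸_; _^_; _≡ᵇ_; _≤ᵇ_; _<_)
open import Data.Bool using (Bool; true; false; if_then_else_; not; _∧_; _xor_)
open import Data.List using (List; []; _∷_; _∷ʳ_; _++_; map; concatMap; upTo;
  zipWith; zip; replicate; concat; take; length)
open import Data.Nat.ListAction using (sum; product)
open import Data.Bool.ListAction using (all; any)
open import Data.List.Properties using (≡-dec)
open import Data.Nat.Properties using (_≟_)
open import Data.Product using (Σ; _×_; _,_)
open import Relation.Nullary.Decidable using (does)
open import Relation.Binary.PropositionalEquality using (_≡_)

interval : ℕ → ℕ → List ℕ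
interval lo hi = map (λ d → suc lo + d) (upTo (hi ∸ lo))

memᵇ : ℕ → List ℕ → Bool
memᵇ m xs = any (λ x → x ≡ᵇ m) xs

iffᵇ : Bool → Bool → Bool
iffᵇ a b = not (a xor b)

eqListᵇ : List ℕ → List ℕ → Bool
eqListᵇ xs ys = does (≡-dec _≟_ xs ys)

prefixSums : ℕ → List ℕ → List ℕ
prefixSums acc []       = []
prefixSums acc (x ∷ xs) = (acc + x) ∷ prefixSums (acc + x) xs

suffixSums : List ℕ → List ℕ
suffixSums []       = []
suffixSums (x ∷ xs) = (x + sum xs) ∷ suffixSums xs

-- α is a *left* weak composition: nonempty with positive last entry.
LastPositive : List ℕ → Set
LastPositive α = Σ (List ℕ) λ α' → Σ ℕ λ a → (α ≡ α' ∷ʳ a) × (0 < a)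

-- Formal power series in X = {x₁, x₂, …} are determined by their
-- coefficients; a monomial x₁^{e₁}⋯x_B^{e_B} is given by the list
-- e = [e₁,…,e_B].  Its coefficient in a (quasi)monomial series is
-- computed in the truncation to the variables x₁,…,x_B (all other
-- variables set to 0), which has the same coefficient of x^e.

incSeqsFrom : ℕ → ℕ → ℕ → List (List ℕ)
incSeqsFrom B lo zero    = [] ∷ []
incSeqsFrom B lo (suc k) =
  concatMap (λ i → map (i ∷_) (incSeqsFrom B i k)) (interval lo B)

incSeqs : ℕ → ℕ → List (List ℕ)
incSeqs B k = incSeqsFrom B 0 k

expAt : ℕ → List ℕ → List ℕ → ℕ
expAt p is as = sum (zipWith (λ i a → if i ≡ᵇ p then a else 0) is as)

monomial : ℕ → List ℕ → List ℕ → List ℕ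
monomial B is as = map (λ p → expAt p is as) (interval 0 B)

weight : List ℕ → List ℕ → ℕ
weight is β = product (zipWith _^_ is β)

-- coefficient of x^e in  M̂_(α over β) = Σ_{0<i₁<…<i_k} i₁^{β₁}⋯i_k^{β_k} x_{i₁}^{α₁}⋯x_{i_k}^{α_k}
coeffMhat : List ℕ → List ℕ → List ℕ → ℕ
coeffMhat α β e =
  sum (map (λ is → if eqListᵇ (monomial (length e) is α) e then weight is β else 0)
           (incSeqs (length e) (length α)))

-- coefficient of x^e in  M_γ = Σ_{0<i₁<…<i_m} x_{i₁}^{γ₁}⋯x_{i_m}^{γ_m}
coeffM : List ℕ → List ℕ → ℕ
coeffM γ e =
  sum (map (λ is → if eqListᵇ (monomial (length e) is γ) e then 1 else 0)
           (incSeqs (length e) (length γ)))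

padded : List ℕ → List ℕ → List ℕ
padded I α = concat (zipWith (λ i a → replicate i 0 ∷ʳ a) I α)

boundedSeqs : List ℕ → List (List ℕ)
boundedSeqs []       = [] ∷ []
boundedSeqs (u ∷ us) = concatMap (λ i → map (i ∷_) (boundedSeqs us)) (upTo (suc u))

indexSet : List ℕ → List (List ℕ)
indexSet β = boundedSeqs (suffixSums β)

-- all maps f : {1,…,len} → {1,…,N}, as lists [f(1),…,f(len)]
allMaps : ℕ → ℕ → List (List ℕ)
allMaps zero    N = [] ∷ []
allMaps (suc l) N = concatMap (λ v → map (v ∷_) (allMaps l N)) (interval 0 N)

-- last element of a list (0 for the empty list; n₀ = 0)
lastOr0 : List ℕ → ℕ
lastOr0 []       = 0
lastOr0 (x ∷ []) = x
lastOr0 (x ∷ xs) = lastOr0 xs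

-- Number of filtered pointed maps  f̄ : {1,…,b_k} ∪ {u₁,…,u_k} → {1,…,n_k}
-- (for the given n₁ < … < n_k, and subsets Y_j ⊆ {n_{j-1}+1,…,n_j-1}) such that
--   f̄({1,…,b_j}) ⊆ {1,…,n_j},  f̄(u_j) = n_j,  and
--   image(f̄) ∩ {n_{j-1}+1,…,n_j-1} = Y_j  for every j.
-- The map f̄ is encoded by f = [f̄(1),…,f̄(b_k)]; the values on u_j are forced.
filteredPointedCount : List ℕ → List ℕ → List (List ℕ) → ℕ
filteredPointedCount β ns Ys =
  sum (map (λ f → if good f then 1 else 0) (allMaps bk (lastOr0 ns)))
  where
  bs : List ℕ
  bs = prefixSums 0 β
  bk : ℕ
  bk = lastOr0 bs
  inImage : List ℕ → ℕ → Bool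
  inImage f m = memᵇ m f Data.Bool.∨ memᵇ m ns
  filtered : List ℕ → Bool
  filtered f = all (λ bn → all (λ v → v ≤ᵇ (Data.Product.proj₂ bn)) (take (Data.Product.proj₁ bn) f))
                   (zip bs ns)
  imageOK : List ℕ → Bool
  imageOK f = all (λ gy → all (λ m → iffᵇ (inImage f m) (memᵇ m (Data.Product.proj₂ gy)))
                                 (Data.Product.proj₁ gy))
                  (zip (zipWith (λ prev n → interval prev (n ∸ 1)) (0 ∷ ns) ns) Ys)
  good : List ℕ → Bool
  good f = filtered f ∧ imageOK f

-- c_{β,I}: uses the canonical choice n_j = n_{j-1} + i_j + 1 (n₀ = 0) and
-- Y_j = {n_{j-1}+1,…,n_j-1} (which has size i_j); convention c_{0^k,I} = 1.
canonNs : List ℕ → List ℕ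
canonNs I = prefixSums 0 (map suc I)

c : List ℕ → List ℕ → ℕ
c β I =
  if all (λ b → b ≡ᵇ 0) β then 1
  else filteredPointedCount β ns (zipWith (λ prev n → interval prev (n ∸ 1)) (0 ∷ ns) ns)
  where
  ns : List ℕ
  ns = canonNs I

-- Both sides are sums over strictly increasing s = (n₁ < ⋯ < n_k) of x_{n₁}^{α₁}⋯x_{n_k}^{α_k}: an index
-- sequence t of M_{(0^{i₁},α₁,…,0^{i_k},α_k)} contributes through its entries at the positions of the αⱼ.
-- So it suffices that n₁^{β₁}⋯n_k^{β_k} = Σ_I c_{β,I} · #{t : the entries of t at those positions are s}.
-- The left side counts the maps f : {1,…,b_k} → {1,2,…} with f({1,…,b_j}) ⊆ {1,…,n_j}. Such an f
-- determines the increasing list t of its image together with s, the numbers I of image points in the gaps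
-- between consecutive nⱼ, and the relabelling g = rank_t ∘ f. This is a bijection onto the triples for
-- which t restricts to s and g is a filtered pointed map for the canonical positions
-- nⱼ = (i₁+1)+⋯+(iⱼ+1) whose image fills every gap; there are c_{β,I} such g, and I lies in the index
-- set by pigeonhole.

module Submission where

open import Algebra.Properties.CommutativeSemigroup using (interchange; x∙yz≈y∙xz)
open import Data.Bool using (Bool; true; false; if_then_else_; _∧_; _∨_; T)
open import Data.Bool.Properties using (T-≡; T-∧; T-∨; ∧-assoc)
open import Data.Bool.ListAction using (all)
open import Data.Empty using (⊥-elim)
open import Data.List using (List; []; _∷_; applyUpTo; foldr; filterᵇ; _∷ʳ_; _++_; map; concatMap; concat; upTo; zipWith; zip; replicate; take; drop; length)
open import Data.List.Membership.Propositional using (_∈_; _∉_)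
open import Data.List.Membership.Propositional.Properties
  using (∈-map⁻; ∈-map⁺; ∈-concat⁻′; ∈-++⁻; ∈-++⁺ˡ; ∈-++⁺ʳ; ∈-upTo⁻; ∈-filter⁻; ∈-filter⁺)
import Data.List.Properties as List
open import Data.List.Properties
  using (≡-dec; map-applyUpTo; length-++; length-replicate; length-take; drop-drop; take++drop≡id; take-map; take-all;
         ++-assoc; map-cong; length-map; map-∘)
open import Data.List.Relation.Binary.Pointwise using (Pointwise; []; _∷_; Pointwise-length)
open import Data.List.Relation.Unary.All using (All; []; _∷_)
import Data.List.Relation.Unary.All as All
open import Data.List.Relation.Unary.All.Properties using (all⁺; all⁻; ++⁺; take⁺; map⁺)
open import Data.List.Relation.Unary.Any using (here; there)
import Data.List.Relation.Unary.Any as Any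
open import Data.List.Relation.Unary.Any.Properties using (any⁺; any⁻)
open import Data.Nat using (ℕ; zero; suc; _+_; _*_; _∸_; _^_; _≡ᵇ_; _≤ᵇ_; _<_; _≤_; _≰_; z≤n; s≤s; z<s)
open import Data.Nat.ListAction using (sum)
open import Data.Nat.Properties
open import Data.Product using (∃₂; _×_; _,_; proj₁; proj₂; uncurry)
import Data.Product.Properties as Product
open import Data.Sum using (_⊎_; inj₁; inj₂)
open import Function using (_∘_; Equivalence)
open import Relation.Binary.Definitions using (DecidableEquality; tri<; tri≈; tri>)
open import Relation.Binary.PropositionalEquality using (_≡_; _≢_; refl; sym; trans; cong; cong₂; subst; module ≡-Reasoning)
open import Relation.Nullary using (yes; no; ¬_)
open import Relation.Nullary.Decidable using (does; map′; _×-dec_; T?)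

open import Defs

private variable
  A X Y : Set

∑ : List A → (A → ℕ) → ℕ
∑ xs f = sum (map f xs)

syntax ∑ xs (λ x → e) = ∑[ x ← xs ] e

∑-++ : ∀ xs ys (f : A → ℕ) → ∑ (xs ++ ys) f ≡ ∑ xs f + ∑ ys f
∑-++ []       ys f = refl
∑-++ (x ∷ xs) ys f = trans (cong (f x +_) (∑-++ xs ys f)) (sym (+-assoc (f x) _ _))

∑-concatMap : (g : A → List X) (xs : List A) (f : X → ℕ) →
  ∑ (concatMap g xs) f ≡ ∑[ x ← xs ] ∑ (g x) f
∑-concatMap g []       f = refl
∑-concatMap g (x ∷ xs) f = trans (∑-++ (g x) (concatMap g xs) f) (cong (∑ (g x) f +_) (∑-concatMap g xs f))

∑-map : (h : A → X) (xs : List A) (f : X → ℕ) → ∑ (map h xs) f ≡ ∑ xs (f ∘ h)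
∑-map h []       f = refl
∑-map h (x ∷ xs) f = cong (f (h x) +_) (∑-map h xs f)

∑-cong : ∀ (xs : List A) {f g} → (∀ x → x ∈ xs → f x ≡ g x) → ∑ xs f ≡ ∑ xs g
∑-cong []       f≡g = refl
∑-cong (x ∷ xs) f≡g = cong₂ _+_ (f≡g x (here refl)) (∑-cong xs (λ y y∈xs → f≡g y (there y∈xs)))

∑-+ : ∀ (xs : List A) f g → ∑[ x ← xs ] (f x + g x) ≡ ∑ xs f + ∑ xs g
∑-+ []       f g = refl
∑-+ (x ∷ xs) f g = trans (cong (f x + g x +_) (∑-+ xs f g)) (interchange +-commutativeSemigroup (f x) (g x) _ _)

∑-*ˡ : ∀ (xs : List A) k f → ∑[ x ← xs ] (k * f x) ≡ k * ∑ xs f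
∑-*ˡ []       k f = sym (*-zeroʳ k)
∑-*ˡ (x ∷ xs) k f = trans (cong (k * f x +_) (∑-*ˡ xs k f)) (sym (*-distribˡ-+ k (f x) _))

∑-*ʳ : ∀ (xs : List A) k f → ∑[ x ← xs ] (f x * k) ≡ ∑ xs f * k
∑-*ʳ xs k f = trans (∑-cong xs (λ x _ → *-comm (f x) k)) (trans (∑-*ˡ xs k f) (*-comm k _))

∑-zero : ∀ (xs : List A) {f} → (∀ x → x ∈ xs → f x ≡ 0) → ∑ xs f ≡ 0
∑-zero []       f≡0 = refl
∑-zero (x ∷ xs) f≡0 = cong₂ _+_ (f≡0 x (here refl)) (∑-zero xs (λ y y∈xs → f≡0 y (there y∈xs)))

∑-comm : ∀ (xs : List A) (ys : List X) (h : A → X → ℕ) → ∑[ x ← xs ] ∑[ y ← ys ] h x y ≡ ∑[ y ← ys ] ∑[ x ← xs ] h x y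
∑-comm []       ys h = sym (∑-zero ys (λ _ _ → refl))
∑-comm (x ∷ xs) ys h = trans (cong (∑ ys (h x) +_) (∑-comm xs ys h)) (sym (∑-+ ys (h x) _))

∑-const-1 : ∀ (xs : List A) → ∑[ _ ← xs ] 1 ≡ length xs
∑-const-1 []       = refl
∑-const-1 (x ∷ xs) = cong suc (∑-const-1 xs)

∑-mono-≤ : ∀ (xs : List A) {f g} → (∀ x → x ∈ xs → f x ≤ g x) → ∑ xs f ≤ ∑ xs g
∑-mono-≤ []       f≤g = z≤n
∑-mono-≤ (x ∷ xs) f≤g = +-mono-≤ (f≤g x (here refl)) (∑-mono-≤ xs (λ y y∈xs → f≤g y (there y∈xs)))

map-cong-∈ : ∀ (xs : List A) {f g : A → X} → (∀ x → x ∈ xs → f x ≡ g x) → map f xs ≡ map g xs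
map-cong-∈ xs f≡g = List.map-cong-local (All.tabulate (λ {x} x∈ → f≡g x x∈))

𝟙 : Bool → ℕ
𝟙 b = if b then 1 else 0

𝟙-∧ : ∀ a b → 𝟙 (a ∧ b) ≡ 𝟙 a * 𝟙 b
𝟙-∧ true  b = sym (+-identityʳ (𝟙 b))
𝟙-∧ false b = refl

𝟙-T : ∀ {b} → T b → 𝟙 b ≡ 1
𝟙-T {true} _ = refl

𝟙-¬T : ∀ {b} → ¬ T b → 𝟙 b ≡ 0
𝟙-¬T {true}  ¬t = ⊥-elim (¬t _)
𝟙-¬T {false} _  = refl

𝟙≢0⇒T : ∀ {b} → 𝟙 b ≢ 0 → T b
𝟙≢0⇒T {true}  _   = _
𝟙≢0⇒T {false} 1≢0 = ⊥-elim (1≢0 refl)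

𝟙-*-guard : ∀ b {m n} → (T b → m ≡ n) → 𝟙 b * m ≡ 𝟙 b * n
𝟙-*-guard true  m≡n = cong (1 *_) (m≡n _)
𝟙-*-guard false _   = refl

if-then-0 : ∀ b n → (if b then n else 0) ≡ 𝟙 b * n
if-then-0 true  n = sym (+-identityʳ n)
if-then-0 false n = refl

T-ext : ∀ {a b} → (T a → T b) → (T b → T a) → a ≡ b
T-ext {true}  {true}  _  _  = refl
T-ext {true}  {false} ab _  = ⊥-elim (ab _)
T-ext {false} {true}  _  ba = ⊥-elim (ba _)
T-ext {false} {false} _  _  = refl

¬T⇒≡false : ∀ {b} → ¬ T b → b ≡ false
¬T⇒≡false {true}  ¬t = ⊥-elim (¬t _)
¬T⇒≡false {false} _  = refl

all-cong : ∀ {p q : A → Bool} {xs} → All (λ x → p x ≡ q x) xs → all p xs ≡ all q xs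
all-cong []           = refl
all-cong (px≡qx ∷ ps) = cong₂ _∧_ px≡qx (all-cong ps)

all-map : ∀ (q : X → Bool) (h : A → X) xs → all q (map h xs) ≡ all (q ∘ h) xs
all-map q h xs = cong (foldr _∧_ true) (sym (map-∘ xs))

all-++ : ∀ (q : A → Bool) xs ys → all q (xs ++ ys) ≡ all q xs ∧ all q ys
all-++ q []       ys = refl
all-++ q (x ∷ xs) ys = trans (cong (q x ∧_) (all-++ q xs ys)) (sym (∧-assoc (q x) _ _))

all-++-trueˡ : ∀ (q : ℕ → Bool) {xs} → All (T ∘ q) xs → ∀ ys → all q (xs ++ ys) ≡ all q ys
all-++-trueˡ q []         ys = refl
all-++-trueˡ q {_ ∷ xs} (qx ∷ qxs) ys = trans (cong (_∧ all q (xs ++ ys)) (Equivalence.to T-≡ qx)) (all-++-trueˡ q qxs ys)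

∈⇒memᵇ : ∀ {m xs} → m ∈ xs → T (memᵇ m xs)
∈⇒memᵇ {m} m∈ = any⁺ (λ x → x ≡ᵇ m) (Any.map (λ { refl → ≡⇒≡ᵇ m m refl }) m∈)

memᵇ⇒∈ : ∀ {m xs} → T (memᵇ m xs) → m ∈ xs
memᵇ⇒∈ {m} {xs} t = Any.map (λ {x} x≡ᵇm → sym (≡ᵇ⇒≡ x m x≡ᵇm)) (any⁻ _ xs t)

module _ (_≟ᴬ_ : DecidableEquality A) where

  δ : A → A → ℕ
  δ x y = 𝟙 (does (x ≟ᴬ y))

  occurrences : List A → A → ℕ
  occurrences xs x = ∑ xs (δ x)

  δ-refl : ∀ x → δ x x ≡ 1
  δ-refl x with x ≟ᴬ x
  ... | yes _   = refl
  ... | no  x≢x = ⊥-elim (x≢x refl)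

  δ-≢ : ∀ {x y} → x ≢ y → δ x y ≡ 0
  δ-≢ {x} {y} x≢y with x ≟ᴬ y
  ... | yes x≡y = ⊥-elim (x≢y x≡y)
  ... | no  _   = refl

  δ-sym : ∀ x y → δ x y ≡ δ y x
  δ-sym x y with x ≟ᴬ y
  ... | yes refl = sym (δ-refl x)
  ... | no  x≢y  = sym (δ-≢ (x≢y ∘ sym))

  δ≢0⇒≡ : ∀ {x y} → δ x y ≢ 0 → x ≡ y
  δ≢0⇒≡ {x} {y} δ≢0 with x ≟ᴬ y
  ... | yes x≡y = x≡y
  ... | no  _   = ⊥-elim (δ≢0 refl)

  δ-* : ∀ x y (f : A → ℕ) → δ x y * f x ≡ δ x y * f y
  δ-* x y f with x ≟ᴬ y
  ... | yes refl = refl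
  ... | no  _    = refl

  ∑-δ : ∀ ys x (f : A → ℕ) → ∑[ y ← ys ] (δ x y * f y) ≡ occurrences ys x * f x
  ∑-δ ys x f = trans (∑-cong ys (λ y _ → sym (δ-* x y f))) (∑-*ʳ ys (f x) (δ x))

  occurrences-∉ : ∀ xs {x} → x ∉ xs → occurrences xs x ≡ 0
  occurrences-∉ xs x∉xs = ∑-zero xs (λ y y∈xs → δ-≢ (λ { refl → x∉xs y∈xs }))

  occurrences-∈ : ∀ {xs x} → x ∈ xs → 1 ≤ occurrences xs x
  occurrences-∈ {y ∷ _} (here refl) = ≤-trans (≤-reflexive (sym (δ-refl y))) (m≤m+n _ _)
  occurrences-∈ {_ ∷ _} (there x∈xs) = ≤-trans (occurrences-∈ x∈xs) (m≤n+m _ _)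

  ∑-spread : ∀ (ys : List X) (xs : List A) (u : X → ℕ) (χ : X → A) →
    (∀ y → y ∈ ys → u y ≢ 0 → occurrences xs (χ y) ≡ 1) →
    ∑ ys u ≡ ∑[ y ← ys ] ∑[ x ← xs ] (δ (χ y) x * u y)
  ∑-spread ys xs u χ once = ∑-cong ys spread₁
    where
    spread₁ : ∀ y → y ∈ ys → u y ≡ ∑[ x ← xs ] (δ (χ y) x * u y)
    spread₁ y y∈ys with u y ≟ 0
    ... | yes u≡0 = trans u≡0 (sym (∑-zero xs (λ x _ → trans (cong (δ (χ y) x *_) u≡0) (*-zeroʳ (δ (χ y) x)))))
    ... | no  u≢0 = sym (trans (∑-*ʳ xs (u y) (δ (χ y))) (trans (cong (_* u y) (once y y∈ys u≢0)) (+-identityʳ (u y))))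

  ∑-fibres : ∀ (ys : List X) (xs : List A) (h : X → A) (F : A → ℕ) → (∀ y → y ∈ ys → occurrences xs (h y) ≡ 1) →
    ∑[ y ← ys ] F (h y) ≡ ∑[ x ← xs ] (F x * ∑[ y ← ys ] δ (h y) x)
  ∑-fibres ys xs h F once = begin
    ∑[ y ← ys ] F (h y)                             ≡⟨ ∑-spread ys xs (F ∘ h) h (λ y y∈ _ → once y y∈) ⟩
    ∑[ y ← ys ] ∑[ x ← xs ] (δ (h y) x * F (h y))   ≡⟨ ∑-cong ys (λ y _ → ∑-cong xs (λ x _ → δ-* (h y) x F)) ⟩
    ∑[ y ← ys ] ∑[ x ← xs ] (δ (h y) x * F x)       ≡⟨ ∑-comm ys xs _ ⟩
    ∑[ x ← xs ] ∑[ y ← ys ] (δ (h y) x * F x)       ≡⟨ ∑-cong xs (λ x _ → trans (∑-*ʳ ys (F x) (λ y → δ (h y) x)) (*-comm _ (F x))) ⟩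
    ∑[ x ← xs ] (F x * ∑[ y ← ys ] δ (h y) x)       ∎
    where open ≡-Reasoning

module _ (_≟ᴬ_ : DecidableEquality A) (_≟ˣ_ : DecidableEquality X)
         (xs : List A) (ys : List X) (w : A → ℕ) (v : X → ℕ) (φ : A → X) (ψ : X → A) where

  ∑-bijection :
    (∀ x → x ∈ xs → w x ≢ 0 → occurrences _≟ˣ_ ys (φ x) ≡ 1 × ψ (φ x) ≡ x × v (φ x) ≡ w x) →
    (∀ y → y ∈ ys → v y ≢ 0 → occurrences _≟ᴬ_ xs (ψ y) ≡ 1 × φ (ψ y) ≡ y × w (ψ y) ≡ v y) →
    ∑ xs w ≡ ∑ ys v
  ∑-bijection to from = begin
    ∑ xs w                                          ≡⟨ ∑-spread _≟ˣ_ xs ys w φ (λ x x∈ w≢0 → proj₁ (to x x∈ w≢0)) ⟩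
    ∑[ x ← xs ] ∑[ y ← ys ] (δ _≟ˣ_ (φ x) y * w x)  ≡⟨ ∑-comm xs ys _ ⟩
    ∑[ y ← ys ] ∑[ x ← xs ] (δ _≟ˣ_ (φ x) y * w x)  ≡⟨ ∑-cong ys (λ y y∈ → ∑-cong xs (λ x x∈ → termwise x y x∈ y∈)) ⟩
    ∑[ y ← ys ] ∑[ x ← xs ] (δ _≟ᴬ_ (ψ y) x * v y)  ≡⟨ ∑-spread _≟ᴬ_ ys xs v ψ (λ y y∈ v≢0 → proj₁ (from y y∈ v≢0)) ⟨
    ∑ ys v                                          ∎
    where
    open ≡-Reasoning
    agree : ∀ x → x ∈ xs → φ x ∈ ys → ψ (φ x) ≡ x → w x ≡ v (φ x)
    agree x x∈ φx∈ ψφx≡x with w x ≟ 0 | v (φ x) ≟ 0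
    ... | no  w≢0 | _       = sym (proj₂ (proj₂ (to x x∈ w≢0)))
    ... | yes w≡0 | yes v≡0 = trans w≡0 (sym v≡0)
    ... | yes _   | no  v≢0 = trans (cong w (sym ψφx≡x)) (proj₂ (proj₂ (from (φ x) φx∈ v≢0)))
    w≡0 : ∀ x → x ∈ xs → ψ (φ x) ≢ x → w x ≡ 0
    w≡0 x x∈ ψφx≢x with w x ≟ 0
    ... | yes w≡0 = w≡0
    ... | no  w≢0 = ⊥-elim (ψφx≢x (proj₁ (proj₂ (to x x∈ w≢0))))
    v≡0 : ∀ y → y ∈ ys → φ (ψ y) ≢ y → v y ≡ 0
    v≡0 y y∈ φψy≢y with v y ≟ 0
    ... | yes v≡0 = v≡0
    ... | no  v≢0 = ⊥-elim (φψy≢y (proj₁ (proj₂ (from y y∈ v≢0))))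
    termwise : ∀ x y → x ∈ xs → y ∈ ys → δ _≟ˣ_ (φ x) y * w x ≡ δ _≟ᴬ_ (ψ y) x * v y
    termwise x y x∈ y∈ with φ x ≟ˣ y | ψ y ≟ᴬ x
    ... | yes refl | yes ψφx≡x = cong (_+ 0) (agree x x∈ y∈ ψφx≡x)
    ... | yes refl | no  ψφx≢x = cong (_+ 0) (w≡0 x x∈ ψφx≢x)
    ... | no  φψy≢y | yes refl = sym (cong (_+ 0) (v≡0 y y∈ φψy≢y))
    ... | no  _     | no  _    = refl

module _ {_⊕_ : A → X → Y} where

  ∈-concatMap-map⁻ : ∀ (G : A → List X) as {y} → y ∈ concatMap (λ a → map (a ⊕_) (G a)) as →
    ∃₂ λ a x → a ∈ as × x ∈ G a × y ≡ a ⊕ x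
  ∈-concatMap-map⁻ G as y∈ with ∈-concat⁻′ (map (λ a → map (a ⊕_) (G a)) as) y∈
  ... | _ , y∈ys , ys∈ with ∈-map⁻ _ ys∈
  ... | a , a∈as , refl with ∈-map⁻ _ y∈ys
  ... | x , x∈Ga , refl = a , x , a∈as , x∈Ga , refl

  occurrences-concatMap-map : (_≟ᴬ_ : DecidableEquality A) (_≟ˣ_ : DecidableEquality X) (_≟ʸ_ : DecidableEquality Y) →
    (∀ a a′ x x′ → δ _≟ʸ_ (a ⊕ x) (a′ ⊕ x′) ≡ δ _≟ᴬ_ a a′ * δ _≟ˣ_ x x′) →
    ∀ (G : A → List X) as a x →
    occurrences _≟ʸ_ (concatMap (λ a′ → map (a′ ⊕_) (G a′)) as) (a ⊕ x) ≡ occurrences _≟ᴬ_ as a * occurrences _≟ˣ_ (G a) x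
  occurrences-concatMap-map _≟ᴬ_ _≟ˣ_ _≟ʸ_ δ-⊕ G as a x = begin
    ∑ (concatMap (λ a′ → map (a′ ⊕_) (G a′)) as) (δ _≟ʸ_ (a ⊕ x))
      ≡⟨ ∑-concatMap _ as _ ⟩
    ∑[ a′ ← as ] ∑ (map (a′ ⊕_) (G a′)) (δ _≟ʸ_ (a ⊕ x))
      ≡⟨ ∑-cong as (λ a′ _ → ∑-map _ (G a′) _) ⟩
    ∑[ a′ ← as ] ∑[ x′ ← G a′ ] δ _≟ʸ_ (a ⊕ x) (a′ ⊕ x′)
      ≡⟨ ∑-cong as (λ a′ _ → trans (∑-cong (G a′) (λ x′ _ → δ-⊕ a a′ x x′)) (∑-*ˡ (G a′) (δ _≟ᴬ_ a a′) (δ _≟ˣ_ x))) ⟩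
    ∑[ a′ ← as ] (δ _≟ᴬ_ a a′ * occurrences _≟ˣ_ (G a′) x)
      ≡⟨ ∑-δ _≟ᴬ_ as a (λ a′ → occurrences _≟ˣ_ (G a′) x) ⟩
    occurrences _≟ᴬ_ as a * occurrences _≟ˣ_ (G a) x ∎
    where open ≡-Reasoning

δ-∷ : (_≟ᴬ_ : DecidableEquality A) → ∀ x y xs ys → δ (≡-dec _≟ᴬ_) (x ∷ xs) (y ∷ ys) ≡ δ _≟ᴬ_ x y * δ (≡-dec _≟ᴬ_) xs ys
δ-∷ _≟ᴬ_ x y xs ys = 𝟙-∧ (does (x ≟ᴬ y)) _

_≟×_ : DecidableEquality A → DecidableEquality X → DecidableEquality (A × X)
(_≟ᴬ_ ≟× _≟ˣ_) (a , x) (a′ , x′) = map′ (uncurry (cong₂ _,_)) Product.,-injective (a ≟ᴬ a′ ×-dec x ≟ˣ x′)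

δ-, : (_≟ᴬ_ : DecidableEquality A) (_≟ˣ_ : DecidableEquality X) → ∀ a a′ x x′ →
  δ (_≟ᴬ_ ≟× _≟ˣ_) (a , x) (a′ , x′) ≡ δ _≟ᴬ_ a a′ * δ _≟ˣ_ x x′
δ-, _≟ᴬ_ _≟ˣ_ a a′ x x′ = 𝟙-∧ (does (a ≟ᴬ a′)) _

∸-suc : ∀ {a m} → a < m → m ∸ a ≡ suc (m ∸ suc a)
∸-suc {a} {suc m} (s≤s a≤m) = +-∸-assoc 1 a≤m

≤∸1⇒< : ∀ {p x} → 1 ≤ x → p ≤ x ∸ 1 → p < x
≤∸1⇒< {x = suc x} _ p≤x = s≤s p≤x

<⇒≤∸1 : ∀ {p x} → p < x → p ≤ x ∸ 1
<⇒≤∸1 {x = suc x} (s≤s p≤x) = p≤x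

range : ℕ → ℕ → List ℕ
range a zero    = []
range a (suc n) = a ∷ range (suc a) n

applyUpTo-range : ∀ a n (f : ℕ → ℕ) → (∀ d → f d ≡ a + d) → applyUpTo f n ≡ range a n
applyUpTo-range a zero    f f≗a+ = refl
applyUpTo-range a (suc n) f f≗a+ = cong₂ _∷_ (trans (f≗a+ 0) (+-identityʳ a))
  (applyUpTo-range (suc a) n (f ∘ suc) (λ d → trans (f≗a+ (suc d)) (+-suc a d)))

upTo-range : ∀ n → upTo n ≡ range 0 n
upTo-range n = applyUpTo-range 0 n (λ d → d) (λ _ → refl)

interval-range : ∀ lo hi → interval lo hi ≡ range (suc lo) (hi ∸ lo)
interval-range lo hi = trans (map-applyUpTo (λ d → d) (suc lo +_) (hi ∸ lo)) (applyUpTo-range (suc lo) (hi ∸ lo) _ (λ _ → refl))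

∈-range⁻ : ∀ {a n x} → x ∈ range a n → a ≤ x × x < a + n
∈-range⁻ {a} {suc n} (here refl) = ≤-refl , m<m+n a z<s
∈-range⁻ {a} {suc n} {x} (there x∈) with ∈-range⁻ x∈
... | a<x , x<end = <⇒≤ a<x , subst (x <_) (sym (+-suc a n)) x<end

occurrences-range : ∀ {a n x} → a ≤ x → x < a + n → occurrences _≟_ (range a n) x ≡ 1
occurrences-range {a} {zero}  a≤x x<a+0 = ⊥-elim (<⇒≱ x<a+0 (subst (_≤ _) (sym (+-identityʳ a)) a≤x))
occurrences-range {a} {suc n} {x} a≤x x<end with x ≟ a
... | yes refl = cong₂ _+_ (δ-refl _≟_ x) (occurrences-∉ _≟_ (range (suc x) n) (λ x∈ → <-irrefl refl (proj₁ (∈-range⁻ x∈))))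
... | no  x≢a  = cong₂ _+_ (δ-≢ _≟_ x≢a) (occurrences-range (≤∧≢⇒< a≤x (x≢a ∘ sym)) (subst (x <_) (+-suc a n) x<end))

∈-range⁺ : ∀ {a n x} → a ≤ x → x < a + n → x ∈ range a n
∈-range⁺ {a} {zero}  a≤x x<a+0 = ⊥-elim (<⇒≱ x<a+0 (subst (_≤ _) (sym (+-identityʳ a)) a≤x))
∈-range⁺ {a} {suc n} {x} a≤x x<end with x ≟ a
... | yes refl = here refl
... | no  x≢a  = there (∈-range⁺ (≤∧≢⇒< a≤x (x≢a ∘ sym)) (subst (x <_) (+-suc a n) x<end))

length-range : ∀ a n → length (range a n) ≡ n
length-range a zero    = refl
length-range a (suc n) = cong suc (length-range (suc a) n)

range-++ : ∀ a m n → range a (m + n) ≡ range a m ++ range (a + m) n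
range-++ a zero    n = cong (λ b → range b n) (sym (+-identityʳ a))
range-++ a (suc m) n = cong (a ∷_) (trans (range-++ (suc a) m n) (cong (λ b → range (suc a) m ++ range b n) (sym (+-suc a m))))

interval-end : ∀ {lo hi} → lo ≤ hi → suc lo + (hi ∸ lo) ≡ suc hi
interval-end lo≤hi = cong suc (m+[n∸m]≡n lo≤hi)

∈-interval⁻ : ∀ {lo hi x} → x ∈ interval lo hi → lo < x × x ≤ hi
∈-interval⁻ {lo} {hi} {x} x∈ with ∈-range⁻ (subst (x ∈_) (interval-range lo hi) x∈) | lo ≤? hi
... | lo<x , x<end | yes lo≤hi = lo<x , m<1+n⇒m≤n (subst (x <_) (interval-end lo≤hi) x<end)
... | lo<x , x<end | no  lo≰hi = ⊥-elim (<⇒≱ x<end (subst (_≤ x) (sym (end≡ lo≰hi)) lo<x))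
  where
  end≡ : lo ≰ hi → suc lo + (hi ∸ lo) ≡ suc lo
  end≡ lo≰hi = trans (cong (suc lo +_) (m≤n⇒m∸n≡0 (<⇒≤ (≰⇒> lo≰hi)))) (+-identityʳ (suc lo))

∈-interval⁺ : ∀ {lo hi x} → lo < x → x ≤ hi → x ∈ interval lo hi
∈-interval⁺ {lo} {hi} {x} lo<x x≤hi = subst (x ∈_) (sym (interval-range lo hi))
  (∈-range⁺ lo<x (subst (x <_) (sym (interval-end (≤-trans (<⇒≤ lo<x) x≤hi))) (s≤s x≤hi)))

occurrences-interval : ∀ {lo hi x} → lo < x → x ≤ hi → occurrences _≟_ (interval lo hi) x ≡ 1
occurrences-interval {lo} {hi} {x} lo<x x≤hi = trans (cong (λ xs → occurrences _≟_ xs x) (interval-range lo hi))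
  (occurrences-range lo<x (subst (x <_) (sym (interval-end (≤-trans (<⇒≤ lo<x) x≤hi))) (s≤s x≤hi)))

data Ascending (B : ℕ) : ℕ → List ℕ → Set where
  []  : ∀ {lo} → Ascending B lo []
  _∷_ : ∀ {lo x xs} → lo < x × x ≤ B → Ascending B x xs → Ascending B lo (x ∷ xs)

Ascending-weaken : ∀ {B lo lo′ xs} → lo′ ≤ lo → Ascending B lo xs → Ascending B lo′ xs
Ascending-weaken lo′≤lo []                     = []
Ascending-weaken lo′≤lo ((lo<x , x≤B) ∷ asc) = (≤-<-trans lo′≤lo lo<x , x≤B) ∷ asc

∈-Ascending : ∀ {B lo xs x} → Ascending B lo xs → x ∈ xs → lo < x × x ≤ B
∈-Ascending (bounds ∷ asc) (here refl) = bounds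
∈-Ascending ((lo<y , _) ∷ asc) (there x∈) with ∈-Ascending asc x∈
... | y<x , x≤B = <-trans lo<y y<x , x≤B

Ascending-++-∷⁻ : ∀ {B lo x} Z rest → Ascending B lo (Z ++ x ∷ rest) →
  Ascending (x ∸ 1) lo Z × lo < x × x ≤ B × Ascending B x rest
Ascending-++-∷⁻ []      rest ((lo<x , x≤B) ∷ asc) = [] , lo<x , x≤B , asc
Ascending-++-∷⁻ {x = x} (z ∷ Z) rest ((lo<z , _) ∷ asc) with Ascending-++-∷⁻ Z rest asc
... | ascZ , z<x , x≤B , ascRest = (lo<z , <⇒≤pred z<x) ∷ ascZ , <-trans lo<z z<x , x≤B , ascRest

Ascending-++-∷⁺ : ∀ {B lo x} Z rest → Ascending (x ∸ 1) lo Z → lo < x → x ≤ B → Ascending B x rest →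
  Ascending B lo (Z ++ x ∷ rest)
Ascending-++-∷⁺ []      rest []                   lo<x x≤B asc = (lo<x , x≤B) ∷ asc
Ascending-++-∷⁺ {x = suc x} (z ∷ Z) rest ((lo<z , z≤x) ∷ ascZ) lo<x x≤B asc =
  (lo<z , ≤-trans (m≤n⇒m≤1+n z≤x) x≤B) ∷ Ascending-++-∷⁺ Z rest ascZ (s≤s z≤x) x≤B asc

Ascending-range : ∀ {B lo a n} → lo < a → a + n ≤ suc B → Ascending B lo (range a n)
Ascending-range {n = zero}      lo<a end≤ = []
Ascending-range {a = a} {suc n} lo<a end≤ =
  (lo<a , m<1+n⇒m≤n (≤-trans (s≤s (m≤m+n a n)) (≤-trans (≤-reflexive (sym (+-suc a n))) end≤)))
  ∷ Ascending-range (n<1+n a) (≤-trans (≤-reflexive (sym (+-suc a n))) end≤)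

Ascending-interval : ∀ lo hi → Ascending hi lo (interval lo hi)
Ascending-interval lo hi with lo ≤? hi
... | yes lo≤hi = subst (Ascending hi lo) (sym (interval-range lo hi)) (Ascending-range (n<1+n lo) (≤-reflexive (interval-end lo≤hi)))
... | no  lo≰hi = subst (Ascending hi lo) (sym (trans (interval-range lo hi) (cong (range (suc lo)) (m≤n⇒m∸n≡0 (<⇒≤ (≰⇒> lo≰hi)))))) []

Ascending-filterᵇ : ∀ {B lo} (q : ℕ → Bool) {xs} → Ascending B lo xs → Ascending B lo (filterᵇ q xs)
Ascending-filterᵇ q []                                  = []
Ascending-filterᵇ q {x ∷ xs} ((lo<x , x≤B) ∷ asc) with q x
... | true  = (lo<x , x≤B) ∷ Ascending-filterᵇ q asc
... | false = Ascending-weaken (<⇒≤ lo<x) (Ascending-filterᵇ q asc)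

Ascending-head-≤ : ∀ {B lo y ys z} → Ascending B lo (y ∷ ys) → z ∈ y ∷ ys → y ≤ z
Ascending-head-≤ _         (here refl) = ≤-refl
Ascending-head-≤ (_ ∷ asc) (there z∈)  = <⇒≤ (proj₁ (∈-Ascending asc z∈))

Ascending-unique : ∀ {B B′ lo lo′ xs ys} → Ascending B lo xs → Ascending B′ lo′ ys →
  (∀ {z} → z ∈ xs → z ∈ ys) → (∀ {z} → z ∈ ys → z ∈ xs) → xs ≡ ys
Ascending-unique []        []        _   _   = refl
Ascending-unique []        (_ ∷ _)   _   ys⊆ with () ← ys⊆ (here refl)
Ascending-unique (_ ∷ _)   []        xs⊆ _   with () ← xs⊆ (here refl)
Ascending-unique {xs = x ∷ xs} {y ∷ ys} ascX@(_ ∷ ascXs) ascY@(_ ∷ ascYs) xs⊆ ys⊆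
  with ≤-antisym (Ascending-head-≤ ascY (xs⊆ (here refl))) (Ascending-head-≤ ascX (ys⊆ (here refl)))
... | refl = cong (x ∷_) (Ascending-unique ascXs ascYs (tail⊆ ys ascXs xs⊆) (tail⊆ xs ascYs ys⊆))
  where
  tail⊆ : ∀ {B us} vs → Ascending B x us → (∀ {z} → z ∈ x ∷ us → z ∈ x ∷ vs) → ∀ {z} → z ∈ us → z ∈ vs
  tail⊆ vs ascUs us⊆ z∈ with us⊆ (there z∈)
  ... | here refl = ⊥-elim (<-irrefl refl (proj₁ (∈-Ascending ascUs z∈)))
  ... | there z∈vs = z∈vs

occurrences-Ascending : ∀ {B lo Z} y → Ascending B lo Z → occurrences _≟_ Z y ≤ 1
occurrences-Ascending y [] = z≤n
occurrences-Ascending {Z = x ∷ Z} y (_ ∷ asc) with y ≟ x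
... | yes refl = ≤-reflexive (cong₂ _+_ (δ-refl _≟_ y) (occurrences-∉ _≟_ Z (λ y∈ → <-irrefl refl (proj₁ (∈-Ascending asc y∈)))))
... | no  y≢x  = subst (_≤ 1) (cong (_+ _) (sym (δ-≢ _≟_ y≢x))) (occurrences-Ascending y asc)

length-≤-⊆ : ∀ {B lo Z} ys → Ascending B lo Z → (∀ {z} → z ∈ Z → z ∈ ys) → length Z ≤ length ys
length-≤-⊆ {Z = Z} ys asc Z⊆ = begin
  length Z                                 ≡⟨ ∑-const-1 Z ⟨
  ∑[ _ ← Z ] 1                             ≤⟨ ∑-mono-≤ Z (λ z z∈ → occurrences-∈ _≟_ (Z⊆ z∈)) ⟩
  ∑[ z ← Z ] ∑[ y ← ys ] δ _≟_ z y         ≡⟨ ∑-comm Z ys (δ _≟_) ⟩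
  ∑[ y ← ys ] ∑[ z ← Z ] δ _≟_ z y         ≡⟨ ∑-cong ys (λ y _ → ∑-cong Z (λ z _ → δ-sym _≟_ z y)) ⟩
  ∑[ y ← ys ] occurrences _≟_ Z y          ≤⟨ ∑-mono-≤ ys (λ y _ → occurrences-Ascending y asc) ⟩
  ∑[ _ ← ys ] 1                            ≡⟨ ∑-const-1 ys ⟩
  length ys                                ∎
  where open ≤-Reasoning

_≟ᴸ_ : DecidableEquality (List ℕ)
_≟ᴸ_ = ≡-dec _≟_

occurrences-conses : ∀ (G : ℕ → List (List ℕ)) is x xs →
  occurrences _≟ᴸ_ (concatMap (λ i → map (i ∷_) (G i)) is) (x ∷ xs) ≡ occurrences _≟_ is x * occurrences _≟ᴸ_ (G x) xs
occurrences-conses = occurrences-concatMap-map _≟_ _≟ᴸ_ _≟ᴸ_ (δ-∷ _≟_)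

InRange : ℕ → ℕ → Set
InRange N v = 0 < v × v ≤ N

∈-incSeqsFrom⁻ : ∀ {B lo k xs} → xs ∈ incSeqsFrom B lo k → Ascending B lo xs × length xs ≡ k
∈-incSeqsFrom⁻ {k = zero} (here refl) = [] , refl
∈-incSeqsFrom⁻ {B} {lo} {suc k} xs∈ with ∈-concatMap-map⁻ (λ i → incSeqsFrom B i k) (interval lo B) xs∈
... | i , ys , i∈ , ys∈ , refl with ∈-incSeqsFrom⁻ ys∈
... | asc , len = ∈-interval⁻ i∈ ∷ asc , cong suc len

occurrences-incSeqsFrom : ∀ {B lo k xs} → Ascending B lo xs → length xs ≡ k → occurrences _≟ᴸ_ (incSeqsFrom B lo k) xs ≡ 1
occurrences-incSeqsFrom {k = zero} [] refl = refl
occurrences-incSeqsFrom {B} {lo} {suc k} ((lo<x , x≤B) ∷ asc) len =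
  trans (occurrences-conses (λ i → incSeqsFrom B i k) (interval lo B) _ _)
    (cong₂ _*_ (occurrences-interval lo<x x≤B) (occurrences-incSeqsFrom asc (suc-injective len)))

∈-allMaps⁻ : ∀ {l N f} → f ∈ allMaps l N → All (InRange N) f × length f ≡ l
∈-allMaps⁻ {zero} (here refl) = [] , refl
∈-allMaps⁻ {suc l} {N} f∈ with ∈-concatMap-map⁻ (λ _ → allMaps l N) (interval 0 N) f∈
... | v , g , v∈ , g∈ , refl with ∈-allMaps⁻ g∈
... | inRange , len = ∈-interval⁻ v∈ ∷ inRange , cong suc len

occurrences-allMaps : ∀ {l N f} → All (InRange N) f → length f ≡ l → occurrences _≟ᴸ_ (allMaps l N) f ≡ 1
occurrences-allMaps {zero} [] refl = refl
occurrences-allMaps {suc l} {N} ((0<v , v≤N) ∷ inRange) len =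
  trans (occurrences-conses (λ _ → allMaps l N) (interval 0 N) _ _)
    (cong₂ _*_ (occurrences-interval 0<v v≤N) (occurrences-allMaps inRange (suc-injective len)))

∈-boundedSeqs⁻ : ∀ {us I} → I ∈ boundedSeqs us → Pointwise _≤_ I us
∈-boundedSeqs⁻ {[]} (here refl) = []
∈-boundedSeqs⁻ {u ∷ us} I∈ with ∈-concatMap-map⁻ (λ _ → boundedSeqs us) (upTo (suc u)) I∈
... | i , J , i∈ , J∈ , refl = m<1+n⇒m≤n (∈-upTo⁻ i∈) ∷ ∈-boundedSeqs⁻ J∈

occurrences-boundedSeqs : ∀ {us I} → Pointwise _≤_ I us → occurrences _≟ᴸ_ (boundedSeqs us) I ≡ 1
occurrences-boundedSeqs [] = refl
occurrences-boundedSeqs {u ∷ us} {i ∷ I} (i≤u ∷ I≤us) =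
  trans (occurrences-conses (λ _ → boundedSeqs us) (upTo (suc u)) i I)
    (cong₂ _*_ (trans (cong (λ is → occurrences _≟_ is i) (upTo-range (suc u))) (occurrences-range z≤n (s≤s i≤u)))
               (occurrences-boundedSeqs I≤us))

head₀ : List ℕ → ℕ
head₀ []      = 0
head₀ (x ∷ _) = x

-- 1-based indexing, with the junk value 0 at index 0 and beyond the end
nth : List ℕ → ℕ → ℕ
nth t zero    = 0
nth t (suc i) = head₀ (drop i t)

nth-suc : ∀ {x t m} → 1 ≤ m → nth (x ∷ t) (suc m) ≡ nth t m
nth-suc {m = suc _} _ = refl

width : List ℕ → ℕ
width I = sum (map suc I)

select : List ℕ → List ℕ → List ℕ
select []      t = []
select (i ∷ I) t = nth t (suc i) ∷ select I (drop (suc i) t)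

pieces : List ℕ → List ℕ → List (List ℕ)
pieces []      t = []
pieces (i ∷ I) t = take i t ∷ pieces I (drop (suc i) t)

join : List (List ℕ) → List ℕ → List ℕ
join (Z ∷ Zs) (x ∷ s) = Z ++ x ∷ join Zs s
join _        _       = []

length-select : ∀ I t → length (select I t) ≡ length I
length-select []      t = refl
length-select (i ∷ I) t = cong suc (length-select I (drop (suc i) t))

length-pieces : ∀ I t → length (pieces I t) ≡ length I
length-pieces []      t = refl
length-pieces (i ∷ I) t = cong suc (length-pieces I (drop (suc i) t))

length-join : ∀ Zs s → length Zs ≡ length s → length (join Zs s) ≡ width (map length Zs)
length-join []       []      _   = refl
length-join (Z ∷ Zs) (x ∷ s) len = trans (length-++ Z) (trans (+-suc (length Z) _)
  (cong (λ n → suc (length Z + n)) (length-join Zs s (suc-injective len))))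

length-drop-width : ∀ i I (t : List ℕ) → length t ≡ width (i ∷ I) → length (drop i t) ≡ suc (width I)
length-drop-width i I t len = trans (List.length-drop i t) (trans (cong (_∸ i) (trans len (sym (+-suc i (width I))))) (m+n∸m≡n i _))

drop-view : ∀ i I (t : List ℕ) → length t ≡ width (i ∷ I) →
  ∃₂ λ x rest → drop i t ≡ x ∷ rest × drop (suc i) t ≡ rest × length rest ≡ width I
drop-view i I t len with drop i t in eq
... | []       = ⊥-elim (0≢1+n (trans (cong length (sym eq)) (length-drop-width i I t len)))
... | x ∷ rest = x , rest , refl , drop-suc , suc-injective (trans (cong length (sym eq)) (length-drop-width i I t len))
  where
  drop-suc : drop (suc i) t ≡ rest
  drop-suc = trans (cong (λ n → drop n t) (+-comm 1 i)) (trans (sym (drop-drop i 1 t)) (cong (drop 1) eq))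

join-pieces : ∀ I t → length t ≡ width I → join (pieces I t) (select I t) ≡ t
join-pieces []      []      _   = refl
join-pieces (i ∷ I) t       len with drop-view i I t len
... | x , rest , drop-i≡ , drop-suc-i≡ , len-rest = begin
  take i t ++ nth t (suc i) ∷ join (pieces I (drop (suc i) t)) (select I (drop (suc i) t))
    ≡⟨ cong₂ (λ y r → take i t ++ y ∷ r) (cong head₀ drop-i≡)
             (trans (cong (λ r → join (pieces I r) (select I r)) drop-suc-i≡) (join-pieces I rest len-rest)) ⟩
  take i t ++ x ∷ rest  ≡⟨ cong (take i t ++_) drop-i≡ ⟨
  take i t ++ drop i t  ≡⟨ take++drop≡id i t ⟩
  t                     ∎
  where open ≡-Reasoning

map-length-pieces : ∀ I t → length t ≡ width I → map length (pieces I t) ≡ I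
map-length-pieces []      t _   = refl
map-length-pieces (i ∷ I) t len with drop-view i I t len
... | _ , rest , _ , drop-suc-i≡ , len-rest =
  cong₂ _∷_ (trans (length-take i t) (m≤n⇒m⊓n≡m (≤-trans (m≤m+n i _) (≤-reflexive (sym (trans len (sym (+-suc i (width I)))))))))
            (trans (cong (λ r → map length (pieces I r)) drop-suc-i≡) (map-length-pieces I rest len-rest))

take-length-++ : ∀ (xs : List ℕ) {ys} → take (length xs) (xs ++ ys) ≡ xs
take-length-++ []       = refl
take-length-++ (x ∷ xs) = cong (x ∷_) (take-length-++ xs)

drop-++-∷ : ∀ (Z : List ℕ) x J → drop (suc (length Z)) (Z ++ x ∷ J) ≡ J
drop-++-∷ []      x J = refl
drop-++-∷ (z ∷ Z) x J = drop-++-∷ Z x J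

nth-++-∷ : ∀ (Z : List ℕ) x J → nth (Z ++ x ∷ J) (suc (length Z)) ≡ x
nth-++-∷ []      x J = refl
nth-++-∷ (z ∷ Z) x J = nth-++-∷ Z x J

nth-++ˡ : ∀ (Z : List ℕ) ys {m} → 1 ≤ m → m ≤ length Z → nth (Z ++ ys) m ≡ nth Z m
nth-++ˡ (z ∷ Z) ys {suc zero}    _ _         = refl
nth-++ˡ (z ∷ Z) ys {suc (suc i)} _ (s≤s i<) = nth-++ˡ Z ys z<s i<

nth-++-∷ʳ : ∀ (Z : List ℕ) x J {k} → 1 ≤ k → nth (Z ++ x ∷ J) (suc (length Z) + k) ≡ nth J k
nth-++-∷ʳ []      x J 1≤k = nth-suc 1≤k
nth-++-∷ʳ (z ∷ Z) x J 1≤k = nth-++-∷ʳ Z x J 1≤k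

select-join : ∀ Zs s → length Zs ≡ length s → select (map length Zs) (join Zs s) ≡ s
select-join []       []      _   = refl
select-join (Z ∷ Zs) (x ∷ s) len = cong₂ _∷_ (nth-++-∷ Z x (join Zs s))
  (trans (cong (select (map length Zs)) (drop-++-∷ Z x (join Zs s))) (select-join Zs s (suc-injective len)))

pieces-join : ∀ Zs s → length Zs ≡ length s → pieces (map length Zs) (join Zs s) ≡ Zs
pieces-join []       []      _   = refl
pieces-join (Z ∷ Zs) (x ∷ s) len = cong₂ _∷_ (take-length-++ Z)
  (trans (cong (pieces (map length Zs)) (drop-++-∷ Z x (join Zs s))) (pieces-join Zs s (suc-injective len)))

Ascending-join⁻ : ∀ {B lo} Zs s → length Zs ≡ length s → Ascending B lo (join Zs s) → Ascending B lo s
Ascending-join⁻ []       []      _   _   = []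
Ascending-join⁻ (Z ∷ Zs) (x ∷ s) len asc with Ascending-++-∷⁻ Z (join Zs s) asc
... | _ , lo<x , x≤B , ascRest = (lo<x , x≤B) ∷ Ascending-join⁻ Zs s (suc-injective len) ascRest

Ascending-select : ∀ {B lo} I t → length t ≡ width I → Ascending B lo t → Ascending B lo (select I t)
Ascending-select I t len asc = Ascending-join⁻ (pieces I t) (select I t)
  (trans (length-pieces I t) (sym (length-select I t))) (subst (Ascending _ _) (sym (join-pieces I t len)) asc)

-- Reduction to an identity for each strictly increasing s

length-padded : ∀ I α → length I ≡ length α → length (padded I α) ≡ width I
length-padded []      []      _   = refl
length-padded (i ∷ I) (a ∷ α) len = begin
  length ((replicate i 0 ∷ʳ a) ++ padded I α)     ≡⟨ length-++ (replicate i 0 ∷ʳ a) ⟩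
  length (replicate i 0 ∷ʳ a) + length (padded I α) ≡⟨ cong₂ _+_ (trans (length-++ (replicate i 0)) (cong (_+ 1) (length-replicate i)))
                                                                  (length-padded I α (suc-injective len)) ⟩
  i + 1 + width I                                   ≡⟨ cong (_+ width I) (+-comm i 1) ⟩
  width (i ∷ I)                                     ∎
  where open ≡-Reasoning

expAt-zeros : ∀ p (Z : List ℕ) ys as → expAt p (Z ++ ys) (replicate (length Z) 0 ++ as) ≡ expAt p ys as
expAt-zeros p []      ys as = refl
expAt-zeros p (z ∷ Z) ys as = trans (cong (_+ _) (if-0-0 (z ≡ᵇ p))) (expAt-zeros p Z ys as)
  where
  if-0-0 : ∀ b → (if b then 0 else 0) ≡ 0
  if-0-0 true  = refl
  if-0-0 false = refl

expAt-join : ∀ p Zs s α → length Zs ≡ length s → length s ≡ length α →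
  expAt p (join Zs s) (padded (map length Zs) α) ≡ expAt p s α
expAt-join p []       []      []      _     _     = refl
expAt-join p (Z ∷ Zs) (x ∷ s) (a ∷ α) len₁ len₂ = begin
  expAt p (Z ++ x ∷ join Zs s) ((replicate (length Z) 0 ∷ʳ a) ++ padded (map length Zs) α)
    ≡⟨ cong (expAt p (Z ++ x ∷ join Zs s)) (++-assoc (replicate (length Z) 0) (a ∷ []) _) ⟩
  expAt p (Z ++ x ∷ join Zs s) (replicate (length Z) 0 ++ a ∷ padded (map length Zs) α)
    ≡⟨ expAt-zeros p Z (x ∷ join Zs s) (a ∷ padded (map length Zs) α) ⟩
  expAt p (x ∷ join Zs s) (a ∷ padded (map length Zs) α)
    ≡⟨ cong (_ +_) (expAt-join p Zs s α (suc-injective len₁) (suc-injective len₂)) ⟩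
  expAt p (x ∷ s) (a ∷ α) ∎
  where open ≡-Reasoning

monomial-padded : ∀ B I α t → length I ≡ length α → length t ≡ width I →
  monomial B t (padded I α) ≡ monomial B (select I t) α
monomial-padded B I α t len-I len-t = begin
  monomial B t (padded I α)
    ≡⟨ cong₂ (λ t′ I′ → monomial B t′ (padded I′ α)) (sym (join-pieces I t len-t)) (sym (map-length-pieces I t len-t)) ⟩
  monomial B (join Zs (select I t)) (padded (map length Zs) α)
    ≡⟨ map-cong (λ p → expAt-join p Zs (select I t) α
                         (trans (length-pieces I t) (sym (length-select I t))) (trans (length-select I t) len-I)) (interval 0 B) ⟩
  monomial B (select I t) α ∎
  where
  open ≡-Reasoning
  Zs = pieces I t

selectFibre : ℕ → List ℕ → List ℕ → ℕ
selectFibre B I s = ∑[ t ← incSeqs B (width I) ] δ _≟ᴸ_ (select I t) s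

∑-select : ∀ B k I (F : List ℕ → ℕ) → length I ≡ k →
  ∑[ t ← incSeqs B (width I) ] F (select I t) ≡ ∑[ s ← incSeqs B k ] (F s * selectFibre B I s)
∑-select B k I F len = ∑-fibres _≟ᴸ_ (incSeqs B (width I)) (incSeqs B k) (select I) F once
  where
  once : ∀ t → t ∈ incSeqs B (width I) → occurrences _≟ᴸ_ (incSeqs B k) (select I t) ≡ 1
  once t t∈ with ∈-incSeqsFrom⁻ t∈
  ... | asc , len-t = occurrences-incSeqsFrom (Ascending-select I t len-t asc) (trans (length-select I t) len)

coeffM-padded : ∀ α I e → length I ≡ length α →
  coeffM (padded I α) e ≡ ∑[ s ← incSeqs (length e) (length α) ] (𝟙 (eqListᵇ (monomial (length e) s α) e) * selectFibre (length e) I s)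
coeffM-padded α I e len = begin
  ∑[ t ← incSeqs B (length (padded I α)) ] 𝟙 (eqListᵇ (monomial B t (padded I α)) e)
    ≡⟨ cong (λ n → ∑[ t ← incSeqs B n ] 𝟙 (eqListᵇ (monomial B t (padded I α)) e)) (length-padded I α len) ⟩
  ∑[ t ← incSeqs B (width I) ] 𝟙 (eqListᵇ (monomial B t (padded I α)) e)
    ≡⟨ ∑-cong (incSeqs B (width I)) (λ t t∈ →
         cong (λ m → 𝟙 (eqListᵇ m e)) (monomial-padded B I α t len (proj₂ (∈-incSeqsFrom⁻ t∈)))) ⟩
  ∑[ t ← incSeqs B (width I) ] 𝟙 (eqListᵇ (monomial B (select I t) α) e)
    ≡⟨ ∑-select B (length α) I (λ s → 𝟙 (eqListᵇ (monomial B s α) e)) len ⟩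
  ∑[ s ← incSeqs B (length α) ] (𝟙 (eqListᵇ (monomial B s α) e) * selectFibre B I s) ∎
  where
  open ≡-Reasoning
  B = length e

length-suffixSums : ∀ β → length (suffixSums β) ≡ length β
length-suffixSums []      = refl
length-suffixSums (b ∷ β) = cong suc (length-suffixSums β)

length-indexSet : ∀ β {I} → I ∈ indexSet β → length I ≡ length β
length-indexSet β I∈ = trans (Pointwise-length (∈-boundedSeqs⁻ {suffixSums β} I∈)) (length-suffixSums β)

coeffMhat-reduction : ∀ α β e → length α ≡ length β →
  (∀ s → s ∈ incSeqs (length e) (length α) → weight s β ≡ ∑[ I ← indexSet β ] (c β I * selectFibre (length e) I s)) →
  coeffMhat α β e ≡ sum (map (λ I → c β I * coeffM (padded I α) e) (indexSet β))
coeffMhat-reduction α β e len expansion = begin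
  ∑[ s ← Ss ] (if eqListᵇ (monomial B s α) e then weight s β else 0)
    ≡⟨ ∑-cong Ss (λ s s∈ → trans (if-then-0 _ (weight s β)) (cong (E s *_) (expansion s s∈))) ⟩
  ∑[ s ← Ss ] (E s * ∑[ I ← Is ] (c β I * selectFibre B I s))
    ≡⟨ ∑-cong Ss (λ s _ → ∑-*ˡ Is (E s) _) ⟨
  ∑[ s ← Ss ] ∑[ I ← Is ] (E s * (c β I * selectFibre B I s))
    ≡⟨ ∑-comm Ss Is _ ⟩
  ∑[ I ← Is ] ∑[ s ← Ss ] (E s * (c β I * selectFibre B I s))
    ≡⟨ ∑-cong Is (λ I _ → ∑-cong Ss (λ s _ → x∙yz≈y∙xz *-commutativeSemigroup (E s) (c β I) _)) ⟩
  ∑[ I ← Is ] ∑[ s ← Ss ] (c β I * (E s * selectFibre B I s))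
    ≡⟨ ∑-cong Is (λ I _ → ∑-*ˡ Ss (c β I) _) ⟩
  ∑[ I ← Is ] (c β I * ∑[ s ← Ss ] (E s * selectFibre B I s))
    ≡⟨ ∑-cong Is (λ I I∈ → cong (c β I *_) (coeffM-padded α I e (trans (length-indexSet β I∈) (sym len)))) ⟨
  ∑[ I ← Is ] (c β I * coeffM (padded I α) e) ∎
  where
  open ≡-Reasoning
  B  = length e
  Ss = incSeqs B (length α)
  Is = indexSet β
  E : List ℕ → ℕ
  E s = 𝟙 (eqListᵇ (monomial B s α) e)

-- The weight of s counts the maps that are filtered by s

filtered : List ℕ → List ℕ → List ℕ → Bool
filtered bs ns f = all (λ bn → all (λ v → v ≤ᵇ proj₂ bn) (take (proj₁ bn) f)) (zip bs ns)

count-≤ᵇ-interval : ∀ {m N} → m ≤ N → ∑[ v ← interval 0 N ] 𝟙 (v ≤ᵇ m) ≡ m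
count-≤ᵇ-interval {m} {N} m≤N = begin
  ∑[ v ← interval 0 N ] 𝟙 (v ≤ᵇ m)
    ≡⟨ cong (λ vs → ∑[ v ← vs ] 𝟙 (v ≤ᵇ m))
         (trans (interval-range 0 N) (trans (cong (range 1) (sym (m+[n∸m]≡n m≤N))) (range-++ 1 m (N ∸ m)))) ⟩
  ∑[ v ← range 1 m ++ range (suc m) (N ∸ m) ] 𝟙 (v ≤ᵇ m)
    ≡⟨ ∑-++ (range 1 m) _ (λ v → 𝟙 (v ≤ᵇ m)) ⟩
  ∑[ v ← range 1 m ] 𝟙 (v ≤ᵇ m) + ∑[ v ← range (suc m) (N ∸ m) ] 𝟙 (v ≤ᵇ m)
    ≡⟨ cong₂ _+_ (∑-cong (range 1 m) (λ v v∈ → 𝟙-T (≤⇒≤ᵇ (m<1+n⇒m≤n (proj₂ (∈-range⁻ v∈))))))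
                 (∑-zero (range (suc m) (N ∸ m)) (λ v v∈ → 𝟙-¬T (λ v≤m → <⇒≱ (proj₁ (∈-range⁻ v∈)) (≤ᵇ⇒≤ v m v≤m)))) ⟩
  ∑[ _ ← range 1 m ] 1 + 0
    ≡⟨ trans (+-identityʳ _) (trans (∑-const-1 (range 1 m)) (length-range 1 m)) ⟩
  m ∎
  where open ≡-Reasoning

∑-allMaps-suc : ∀ l N (F : List ℕ → ℕ) → ∑ (allMaps (suc l) N) F ≡ ∑[ v ← interval 0 N ] ∑[ y ← allMaps l N ] F (v ∷ y)
∑-allMaps-suc l N F = trans (∑-concatMap _ (interval 0 N) F) (∑-cong (interval 0 N) (λ v _ → ∑-map (v ∷_) (allMaps l N) F))

∑-allMaps-+ : ∀ m n N (F : List ℕ → ℕ) →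
  ∑ (allMaps (m + n) N) F ≡ ∑[ y₁ ← allMaps m N ] ∑[ y₂ ← allMaps n N ] F (y₁ ++ y₂)
∑-allMaps-+ zero    n N F = sym (+-identityʳ _)
∑-allMaps-+ (suc m) n N F = trans (∑-allMaps-suc (m + n) N F)
  (trans (∑-cong (interval 0 N) (λ v _ → ∑-allMaps-+ m n N (F ∘ (v ∷_)))) (sym (∑-allMaps-suc m N _)))

count-≤ᵇ-allMaps : ∀ {m N} b → m ≤ N → ∑[ y ← allMaps b N ] 𝟙 (all (λ v → v ≤ᵇ m) y) ≡ m ^ b
count-≤ᵇ-allMaps zero    m≤N = refl
count-≤ᵇ-allMaps {m} {N} (suc b) m≤N = begin
  ∑[ y ← allMaps (suc b) N ] 𝟙 (all (λ v → v ≤ᵇ m) y)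
    ≡⟨ ∑-allMaps-suc b N _ ⟩
  ∑[ v ← interval 0 N ] ∑[ y ← allMaps b N ] 𝟙 ((v ≤ᵇ m) ∧ all (λ v → v ≤ᵇ m) y)
    ≡⟨ ∑-cong (interval 0 N) (λ v _ → trans (∑-cong (allMaps b N) (λ y _ → 𝟙-∧ (v ≤ᵇ m) _))
                                            (∑-*ˡ (allMaps b N) (𝟙 (v ≤ᵇ m)) (𝟙 ∘ all (λ v → v ≤ᵇ m)))) ⟩
  ∑[ v ← interval 0 N ] (𝟙 (v ≤ᵇ m) * ∑[ y ← allMaps b N ] 𝟙 (all (λ v → v ≤ᵇ m) y))
    ≡⟨ ∑-cong (interval 0 N) (λ v _ → cong (𝟙 (v ≤ᵇ m) *_) (count-≤ᵇ-allMaps b m≤N)) ⟩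
  ∑[ v ← interval 0 N ] (𝟙 (v ≤ᵇ m) * m ^ b)
    ≡⟨ ∑-*ʳ (interval 0 N) (m ^ b) (λ v → 𝟙 (v ≤ᵇ m)) ⟩
  ∑[ v ← interval 0 N ] 𝟙 (v ≤ᵇ m) * m ^ b
    ≡⟨ cong (_* m ^ b) (count-≤ᵇ-interval m≤N) ⟩
  m * m ^ b ∎
  where open ≡-Reasoning

count-filtered : ∀ {B lo} β s (prefix : List ℕ) → Ascending B lo s → length s ≡ length β → All (_≤ lo) prefix →
  ∑[ y ← allMaps (sum β) B ] 𝟙 (filtered (prefixSums (length prefix) β) s (prefix ++ y)) ≡ weight s β
count-filtered []      []      prefix _ _ _ = refl
count-filtered {B} (b ∷ β) (x ∷ s) prefix ((lo<x , x≤B) ∷ asc) len prefix≤lo = begin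
  ∑[ y ← allMaps (b + sum β) B ] 𝟙 (filtered (prefixSums a (b ∷ β)) (x ∷ s) (prefix ++ y))
    ≡⟨ ∑-allMaps-+ b (sum β) B _ ⟩
  ∑[ y₁ ← allMaps b B ] ∑[ y₂ ← allMaps (sum β) B ] 𝟙 (filtered (prefixSums a (b ∷ β)) (x ∷ s) (prefix ++ y₁ ++ y₂))
    ≡⟨ ∑-cong (allMaps b B) (λ y₁ y₁∈ → trans (∑-cong (allMaps (sum β) B) (λ y₂ _ → split y₁ y₂ (proj₂ (∈-allMaps⁻ y₁∈))))
                                               (∑-*ˡ (allMaps (sum β) B) (𝟙 (bounded y₁)) _)) ⟩
  ∑[ y₁ ← allMaps b B ] (𝟙 (bounded y₁) *
    ∑[ y₂ ← allMaps (sum β) B ] 𝟙 (filtered (prefixSums (length (prefix ++ y₁)) β) s ((prefix ++ y₁) ++ y₂)))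
    ≡⟨ ∑-cong (allMaps b B) (λ y₁ _ → 𝟙-*-guard (bounded y₁) (λ y₁≤x →
         count-filtered β s (prefix ++ y₁) asc (suc-injective len) (++⁺ (All.map (λ v≤lo → <⇒≤ (≤-<-trans v≤lo lo<x)) prefix≤lo)
                                                                      (All.map (≤ᵇ⇒≤ _ x) (all⁺ _ y₁ y₁≤x))))) ⟩
  ∑[ y₁ ← allMaps b B ] (𝟙 (bounded y₁) * weight s β)
    ≡⟨ ∑-*ʳ (allMaps b B) (weight s β) (𝟙 ∘ bounded) ⟩
  ∑[ y₁ ← allMaps b B ] 𝟙 (bounded y₁) * weight s β
    ≡⟨ cong (_* weight s β) (count-≤ᵇ-allMaps b x≤B) ⟩
  x ^ b * weight s β ∎
  where
  open ≡-Reasoning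
  a = length prefix
  bounded : List ℕ → Bool
  bounded = all (λ v → v ≤ᵇ x)
  split : ∀ y₁ y₂ → length y₁ ≡ b →
    𝟙 (filtered (prefixSums a (b ∷ β)) (x ∷ s) (prefix ++ y₁ ++ y₂))
    ≡ 𝟙 (bounded y₁) * 𝟙 (filtered (prefixSums (length (prefix ++ y₁)) β) s ((prefix ++ y₁) ++ y₂))
  split y₁ y₂ len-y₁ = trans (𝟙-∧ (bounded (take (a + b) (prefix ++ y₁ ++ y₂))) _) (cong₂ _*_
    (cong 𝟙 (begin
      bounded (take (a + b) (prefix ++ y₁ ++ y₂))
        ≡⟨ cong₂ (λ n z → bounded (take n z)) a+b≡ (sym (++-assoc prefix y₁ y₂)) ⟩
      bounded (take (length (prefix ++ y₁)) ((prefix ++ y₁) ++ y₂))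
        ≡⟨ cong bounded (take-length-++ (prefix ++ y₁)) ⟩
      bounded (prefix ++ y₁)
        ≡⟨ all-++-trueˡ _ (All.map (λ v≤lo → ≤⇒≤ᵇ (<⇒≤ (≤-<-trans v≤lo lo<x))) prefix≤lo) y₁ ⟩
      bounded y₁ ∎))
    (cong₂ (λ n z → 𝟙 (filtered (prefixSums n β) s z)) a+b≡ (sym (++-assoc prefix y₁ y₂))))
    where
    a+b≡ : a + b ≡ length (prefix ++ y₁)
    a+b≡ = sym (trans (length-++ prefix) (cong (a +_) len-y₁))

lastOr0-prefixSums : ∀ a x xs → lastOr0 (prefixSums a (x ∷ xs)) ≡ a + sum (x ∷ xs)
lastOr0-prefixSums a x []       = cong (a +_) (sym (+-identityʳ x))
lastOr0-prefixSums a x (y ∷ xs) = trans (lastOr0-prefixSums (a + x) y xs) (+-assoc a x (y + sum xs))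

lastOr0-prefixSums0 : ∀ xs → lastOr0 (prefixSums 0 xs) ≡ sum xs
lastOr0-prefixSums0 []       = refl
lastOr0-prefixSums0 (x ∷ xs) = lastOr0-prefixSums 0 x xs

weight≡count-filtered : ∀ {B} β s → Ascending B 0 s → length s ≡ length β →
  weight s β ≡ ∑[ f ← allMaps (lastOr0 (prefixSums 0 β)) B ] 𝟙 (filtered (prefixSums 0 β) s f)
weight≡count-filtered {B} β s asc len = sym (trans
  (cong (λ n → ∑[ f ← allMaps n B ] 𝟙 (filtered (prefixSums 0 β) s f)) (lastOr0-prefixSums0 β))
  (count-filtered β s [] asc len []))

rank : List ℕ → ℕ → ℕ
rank []      p = 0
rank (x ∷ t) p = if x ≡ᵇ p then 1 else suc (rank t p)

∈-nth : ∀ {t m} → InRange (length t) m → nth t m ∈ t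
∈-nth {x ∷ t} {suc zero}    _               = here refl
∈-nth {x ∷ t} {suc (suc i)} (_ , s≤s i<len) = there (∈-nth (z<s , i<len))

nth-rank : ∀ {t p} → p ∈ t → nth t (rank t p) ≡ p × InRange (length t) (rank t p)
nth-rank {x ∷ t} {p} p∈ with x ≡ᵇ p in eq | p∈
... | true  | _          = ≡ᵇ⇒≡ x p (Equivalence.from T-≡ eq) , s≤s z≤n , s≤s z≤n
... | false | here refl  = ⊥-elim (subst T eq (≡⇒≡ᵇ x x refl))
... | false | there p∈t with nth-rank p∈t
...   | nth≡p , 1≤r , r≤len = trans (nth-suc 1≤r) nth≡p , s≤s z≤n , s≤s r≤len

rank-nth : ∀ {B lo t m} → Ascending B lo t → InRange (length t) m → rank t (nth t m) ≡ m
rank-nth {t = x ∷ t} {suc zero} _ _ = cong (λ b → if b then 1 else suc (rank t x)) (Equivalence.to T-≡ (≡⇒≡ᵇ x x refl))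
rank-nth {t = x ∷ t} {suc (suc i)} (_ ∷ asc) (_ , s≤s i<len) = begin
  (if x ≡ᵇ nth t (suc i) then 1 else suc (rank t (nth t (suc i))))
    ≡⟨ cong (λ b → if b then 1 else suc (rank t (nth t (suc i)))) (¬T⇒≡false (x≢ ∘ ≡ᵇ⇒≡ x _)) ⟩
  suc (rank t (nth t (suc i)))
    ≡⟨ cong suc (rank-nth asc (z<s , i<len)) ⟩
  suc (suc i) ∎
  where
  open ≡-Reasoning
  x≢ : x ≢ nth t (suc i)
  x≢ x≡ = <-irrefl x≡ (proj₁ (∈-Ascending asc (∈-nth (z<s , i<len))))

nth-mono-< : ∀ {B lo t m n} → Ascending B lo t → InRange (length t) m → InRange (length t) n → m < n → nth t m < nth t n
nth-mono-< {t = x ∷ t} {suc zero} {suc zero} _ _ _ (s≤s ())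
nth-mono-< {t = x ∷ t} {suc zero} {suc (suc j)} (_ ∷ asc) _ (_ , s≤s j<len) _ = proj₁ (∈-Ascending asc (∈-nth (z<s , j<len)))
nth-mono-< {t = x ∷ t} {suc (suc i)} {suc (suc j)} (_ ∷ asc) (_ , s≤s i<len) (_ , s≤s j<len) (s≤s i<j) =
  nth-mono-< asc (z<s , i<len) (z<s , j<len) i<j

nth-≤ᵇ : ∀ {B lo t m n} → Ascending B lo t → InRange (length t) m → InRange (length t) n → (nth t m ≤ᵇ nth t n) ≡ (m ≤ᵇ n)
nth-≤ᵇ {t = t} {m} {n} asc m∈ n∈ = T-ext
  (λ nm≤nn → ≤⇒≤ᵇ (≮⇒≥ (λ n<m → <⇒≱ (nth-mono-< asc n∈ m∈ n<m) (≤ᵇ⇒≤ _ _ nm≤nn))))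
  (λ m≤n → ≤⇒≤ᵇ (≮⇒≥ (λ nn<nm → <⇒≱ nn<nm (mono-≤ (≤ᵇ⇒≤ m n m≤n)))))
  where
  mono-≤ : m ≤ n → nth t m ≤ nth t n
  mono-≤ m≤n with m≤n⇒m<n∨m≡n m≤n
  ... | inj₁ m<n  = <⇒≤ (nth-mono-< asc m∈ n∈ m<n)
  ... | inj₂ refl = ≤-refl

filtered-relabel : ∀ {B lo t} bs ns g → Ascending B lo t → All (InRange (length t)) ns → All (InRange (length t)) g →
  filtered bs (map (nth t) ns) (map (nth t) g) ≡ filtered bs ns g
filtered-relabel []       ns       g _   _          _  = refl
filtered-relabel (b ∷ bs) []       g _   _          _  = refl
filtered-relabel {t = t} (b ∷ bs) (n ∷ ns) g asc (n∈ ∷ ns∈) g∈ = cong₂ _∧_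
  (trans (cong (all (λ v → v ≤ᵇ nth t n)) (take-map b g))
  (trans (all-map (λ v → v ≤ᵇ nth t n) (nth t) (take b g))
         (all-cong (All.map (λ v∈ → nth-≤ᵇ asc v∈ n∈) (take⁺ b g∈)))))
  (filtered-relabel bs ns g asc ns∈ g∈)

canonNs-bounds : ∀ a I {n} → n ∈ prefixSums a (map suc I) → a < n × n ≤ a + width I
canonNs-bounds a (i ∷ I) (here refl) = m<m+n a z<s , +-monoʳ-≤ a (m≤m+n (suc i) (width I))
canonNs-bounds a (i ∷ I) (there n∈) with canonNs-bounds (a + suc i) I n∈
... | a+i<n , n≤end = <-trans (m<m+n a z<s) a+i<n , ≤-trans n≤end (≤-reflexive (+-assoc a (suc i) (width I)))

canonNs-InRange : ∀ I → All (InRange (width I)) (canonNs I)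
canonNs-InRange I = All.tabulate (canonNs-bounds 0 I)

lastOr0-canonNs : ∀ I → lastOr0 (canonNs I) ≡ width I
lastOr0-canonNs I = lastOr0-prefixSums0 (map suc I)

nth-canonNs : ∀ a I (t : List ℕ) → map (nth t) (prefixSums a (map suc I)) ≡ select I (drop a t)
nth-canonNs a []      t = refl
nth-canonNs a (i ∷ I) t = cong₂ _∷_
  (trans (cong (nth t) (+-suc a i)) (cong head₀ (sym (drop-drop a i t))))
  (trans (nth-canonNs (a + suc i) I t) (cong (select I) (sym (drop-drop a (suc i) t))))

map-nth-range : ∀ a (Z : List ℕ) → map (λ m → nth Z (m ∸ a)) (range (suc a) (length Z)) ≡ Z
map-nth-range a []      = refl
map-nth-range a (z ∷ Z) = cong₂ _∷_ (cong (nth (z ∷ Z)) (trans (cong (_∸ a) (+-comm 1 a)) (m+n∸m≡n a 1)))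
  (trans (map-cong-∈ (range (suc (suc a)) (length Z)) shift) (map-nth-range (suc a) Z))
  where
  shift : ∀ m → m ∈ range (suc (suc a)) (length Z) → nth (z ∷ Z) (m ∸ a) ≡ nth Z (m ∸ suc a)
  shift m m∈ = trans (cong (nth (z ∷ Z)) (∸-suc a<m)) (nth-suc (m<n⇒0<n∸m (proj₁ (∈-range⁻ m∈))))
    where
    a<m : a < m
    a<m = <-trans (n<1+n a) (proj₁ (∈-range⁻ m∈))

gaps : List ℕ → List (List ℕ)
gaps ns = zipWith (λ prev n → interval prev (n ∸ 1)) (0 ∷ ns) ns

canonGaps : ℕ → List ℕ → List (List ℕ)
canonGaps a []      = []
canonGaps a (i ∷ I) = interval a (a + i) ∷ canonGaps (a + suc i) I

gaps-canonNs : ∀ I → gaps (canonNs I) ≡ canonGaps 0 I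
gaps-canonNs I = go 0 I
  where
  go : ∀ a I → zipWith (λ prev n → interval prev (n ∸ 1)) (a ∷ prefixSums a (map suc I)) (prefixSums a (map suc I)) ≡ canonGaps a I
  go a []      = refl
  go a (i ∷ I) = cong₂ _∷_ (cong (λ n → interval a (n ∸ 1)) (+-suc a i)) (go (a + suc i) I)

∈-canonGaps⁻ : ∀ a I {m} → m ∈ concat (canonGaps a I) → a < m × m ≤ a + width I
∈-canonGaps⁻ a (i ∷ I) {m} m∈ with ∈-++⁻ (interval a (a + i)) m∈
... | inj₁ m∈gap with ∈-interval⁻ m∈gap
...   | a<m , m≤a+i = a<m , ≤-trans m≤a+i (+-monoʳ-≤ a (≤-trans (n≤1+n i) (m≤m+n (suc i) (width I))))
∈-canonGaps⁻ a (i ∷ I) {m} m∈ | inj₂ m∈rest with ∈-canonGaps⁻ (a + suc i) I m∈rest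
...   | a+i<m , m≤end = <-trans (m<m+n a z<s) a+i<m , ≤-trans m≤end (≤-reflexive (+-assoc a (suc i) (width I)))

-- The canonical gaps are exactly the positions of the pieces Zs in join Zs s.
nth-canonGaps : ∀ a Zs s → length Zs ≡ length s →
  map (λ m → nth (join Zs s) (m ∸ a)) (concat (canonGaps a (map length Zs))) ≡ concat Zs
nth-canonGaps a []       []      _   = refl
nth-canonGaps a (Z ∷ Zs) (x ∷ s) len = begin
  map f (interval a (a + length Z) ++ concat rest)
    ≡⟨ List.map-++ f (interval a (a + length Z)) _ ⟩
  map f (interval a (a + length Z)) ++ map f (concat rest)
    ≡⟨ cong₂ _++_ inGap inRest ⟩
  Z ++ concat Zs ∎
  where
  open ≡-Reasoning
  J = join Zs s
  f : ℕ → ℕ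
  f m = nth (Z ++ x ∷ J) (m ∸ a)
  rest = canonGaps (a + suc (length Z)) (map length Zs)
  gap≡range : interval a (a + length Z) ≡ range (suc a) (length Z)
  gap≡range = trans (interval-range a _) (cong (range (suc a)) (m+n∸m≡n a (length Z)))
  inGap : map f (interval a (a + length Z)) ≡ Z
  inGap = begin
    map f (interval a (a + length Z))         ≡⟨ cong (map f) gap≡range ⟩
    map f (range (suc a) (length Z))
      ≡⟨ map-cong-∈ (range (suc a) (length Z)) (λ m m∈ → nth-++ˡ Z (x ∷ J) (proj₁ (bounds m∈)) (proj₂ (bounds m∈))) ⟩
    map (λ m → nth Z (m ∸ a)) (range (suc a) (length Z)) ≡⟨ map-nth-range a Z ⟩
    Z                                         ∎
    where
    bounds : ∀ {m} → m ∈ range (suc a) (length Z) → 1 ≤ m ∸ a × m ∸ a ≤ length Z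
    bounds m∈ with ∈-range⁻ m∈
    ... | a<m , m<end = m<n⇒0<n∸m a<m , subst (_ ≤_) (m+n∸m≡n a (length Z)) (∸-monoˡ-≤ a (m<1+n⇒m≤n m<end))
  inRest : map f (concat rest) ≡ concat Zs
  inRest = trans (map-cong-∈ (concat rest) shift) (nth-canonGaps (a + suc (length Z)) Zs s (suc-injective len))
    where
    shift : ∀ m → m ∈ concat rest → f m ≡ nth J (m ∸ (a + suc (length Z)))
    shift m m∈ = trans (cong (nth (Z ++ x ∷ J)) m∸a≡) (nth-++-∷ʳ Z x J (m<n⇒0<n∸m end<m))
      where
      end<m : a + suc (length Z) < m
      end<m = proj₁ (∈-canonGaps⁻ _ (map length Zs) m∈)
      m∸a≡ : m ∸ a ≡ suc (length Z) + (m ∸ (a + suc (length Z)))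
      m∸a≡ = sym (trans (cong (suc (length Z) +_) (sym (∸-+-assoc m a (suc (length Z)))))
                        (m+[n∸m]≡n (m+n≤o⇒m≤o∸n (suc (length Z)) (≤-trans (≤-reflexive (+-comm _ a)) (<⇒≤ end<m)))))

canonNs-disjoint : ∀ a I {m} → m ∈ prefixSums a (map suc I) → m ∉ concat (canonGaps a I)
canonNs-disjoint a (i ∷ I) {m} m∈ns m∈gaps with ∈-++⁻ (interval a (a + i)) m∈gaps | m∈ns
... | inj₁ m∈gap  | here refl  = <-irrefl refl (≤-<-trans (proj₂ (∈-interval⁻ m∈gap)) (+-monoʳ-< a (n<1+n i)))
... | inj₁ m∈gap  | there m∈ns′ =
  <⇒≱ (<-trans (+-monoʳ-< a (n<1+n i)) (proj₁ (canonNs-bounds (a + suc i) I m∈ns′))) (proj₂ (∈-interval⁻ m∈gap))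
... | inj₂ m∈rest | here refl  = <-irrefl refl (proj₁ (∈-canonGaps⁻ (a + suc i) I m∈rest))
... | inj₂ m∈rest | there m∈ns′ = canonNs-disjoint (a + suc i) I m∈ns′ m∈rest

inImage : List ℕ → List ℕ → ℕ → Bool
inImage ns f m = memᵇ m f ∨ memᵇ m ns

imageOK : List ℕ → List (List ℕ) → List ℕ → Bool
imageOK ns Ys f = all (λ gy → all (λ m → iffᵇ (inImage ns f m) (memᵇ m (proj₂ gy))) (proj₁ gy)) (zip (gaps ns) Ys)

pointed : List ℕ → List ℕ → List ℕ → Bool
pointed β I g = filtered (prefixSums 0 β) (canonNs I) g ∧ imageOK (canonNs I) (gaps (canonNs I)) g

-- When β is not all zeros, c β I unfolds to pointedCount β I.
pointedCount : List ℕ → List ℕ → ℕ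
pointedCount β I = ∑[ g ← allMaps (lastOr0 (prefixSums 0 β)) (lastOr0 (canonNs I)) ] 𝟙 (pointed β I g)

imageOK-canonNs : ∀ I g → imageOK (canonNs I) (gaps (canonNs I)) g ≡ all (inImage (canonNs I) g) (concat (canonGaps 0 I))
imageOK-canonNs I g = trans (diagonal (gaps (canonNs I))) (cong (λ Gs → all (inImage (canonNs I) g) (concat Gs)) (gaps-canonNs I))
  where
  Q = inImage (canonNs I) g
  iffᵇ-true : ∀ b → iffᵇ b true ≡ b
  iffᵇ-true true  = refl
  iffᵇ-true false = refl
  diagonal : ∀ Gs → all (λ gy → all (λ m → iffᵇ (Q m) (memᵇ m (proj₂ gy))) (proj₁ gy)) (zip Gs Gs) ≡ all Q (concat Gs)
  diagonal []       = refl
  diagonal (G ∷ Gs) = trans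
    (cong₂ _∧_ (all-cong {p = λ m → iffᵇ (Q m) (memᵇ m G)} {xs = G} (All.tabulate (λ {m} m∈ →
                  trans (cong (iffᵇ (Q m)) (Equivalence.to T-≡ (∈⇒memᵇ m∈))) (iffᵇ-true (Q m)))))
               (diagonal Gs))
    (sym (all-++ Q G (concat Gs)))

filtered-[] : ∀ bs ns → filtered bs ns [] ≡ true
filtered-[] []             ns       = refl
filtered-[] (b ∷ bs)       []       = refl
filtered-[] (zero ∷ bs)    (n ∷ ns) = filtered-[] bs ns
filtered-[] (suc b ∷ bs)   (n ∷ ns) = filtered-[] bs ns

sum-zeros : ∀ {xs} → All (_≡ 0) xs → sum xs ≡ 0
sum-zeros []          = refl
sum-zeros (refl ∷ xs) = sum-zeros xs

suffixSums-zeros : ∀ {β} → All (_≡ 0) β → All (_≡ 0) (suffixSums β)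
suffixSums-zeros []                 = []
suffixSums-zeros {_ ∷ β} (refl ∷ zs) = sum-zeros zs ∷ suffixSums-zeros zs

≤-zeros : ∀ {I us} → Pointwise _≤_ I us → All (_≡ 0) us → All (_≡ 0) I
≤-zeros []              []          = []
≤-zeros (i≤u ∷ I≤us) (refl ∷ zs) = n≤0⇒n≡0 i≤u ∷ ≤-zeros I≤us zs

concat-canonGaps-zeros : ∀ a {I} → All (_≡ 0) I → concat (canonGaps a I) ≡ []
concat-canonGaps-zeros a []          = refl
concat-canonGaps-zeros a (refl ∷ zs) =
  cong₂ _++_ (trans (interval-range a (a + 0)) (cong (range (suc a)) (m+n∸m≡n a 0))) (concat-canonGaps-zeros (a + 1) zs)

pointedCount-zeros : ∀ β I → All (_≡ 0) β → Pointwise _≤_ I (suffixSums β) → pointedCount β I ≡ 1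
pointedCount-zeros β I zeros I≤ = begin
  ∑[ g ← allMaps (lastOr0 (prefixSums 0 β)) (lastOr0 (canonNs I)) ] 𝟙 (pointed β I g)
    ≡⟨ cong (λ l → ∑[ g ← allMaps l (lastOr0 (canonNs I)) ] 𝟙 (pointed β I g)) (trans (lastOr0-prefixSums0 β) (sum-zeros zeros)) ⟩
  𝟙 (pointed β I []) + 0
    ≡⟨ cong (λ b → 𝟙 b + 0) (cong₂ _∧_ (filtered-[] (prefixSums 0 β) (canonNs I))
         (trans (imageOK-canonNs I []) (cong (all (inImage (canonNs I) [])) (concat-canonGaps-zeros 0 (≤-zeros I≤ (suffixSums-zeros zeros)))))) ⟩
  1 ∎
  where open ≡-Reasoning

c≡pointedCount : ∀ β {I} → I ∈ indexSet β → c β I ≡ pointedCount β I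
c≡pointedCount β {I} I∈ with all (λ b → b ≡ᵇ 0) β in zeros
... | true  = sym (pointedCount-zeros β I (All.map (λ {b} → ≡ᵇ⇒≡ b 0) (all⁺ _ β (Equivalence.from T-≡ zeros))) (∈-boundedSeqs⁻ I∈))
... | false = refl

gapPiece : List ℕ → ℕ → ℕ → List ℕ
gapPiece f lo x = filterᵇ (λ p → memᵇ p f) (interval lo (x ∸ 1))

gapPieces : List ℕ → ℕ → List ℕ → List (List ℕ)
gapPieces f lo []      = []
gapPieces f lo (x ∷ s) = gapPiece f lo x ∷ gapPieces f x s

length-gapPieces : ∀ f lo s → length (gapPieces f lo s) ≡ length s
length-gapPieces f lo []      = refl
length-gapPieces f lo (x ∷ s) = cong suc (length-gapPieces f x s)

Ascending-gapPiece : ∀ f lo x → Ascending (x ∸ 1) lo (gapPiece f lo x)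
Ascending-gapPiece f lo x = Ascending-filterᵇ _ (Ascending-interval lo (x ∸ 1))

∈-gapPiece⁻ : ∀ {f lo x q} → q ∈ gapPiece f lo x → (lo < q × q ≤ x ∸ 1) × q ∈ f
∈-gapPiece⁻ {f} q∈ with ∈-filter⁻ (T? ∘ λ p → memᵇ p f) q∈
... | q∈gap , q∈f = ∈-interval⁻ q∈gap , memᵇ⇒∈ q∈f

∈-gapPiece⁺ : ∀ {f lo x q} → lo < q → q ≤ x ∸ 1 → q ∈ f → q ∈ gapPiece f lo x
∈-gapPiece⁺ {f} lo<q q≤ q∈f = ∈-filter⁺ (T? ∘ λ p → memᵇ p f) (∈-interval⁺ lo<q q≤) (∈⇒memᵇ q∈f)

Ascending-join-gapPieces : ∀ {B lo} f s → Ascending B lo s → Ascending B lo (join (gapPieces f lo s) s)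
Ascending-join-gapPieces f []      []                   = []
Ascending-join-gapPieces f (x ∷ s) ((lo<x , x≤B) ∷ asc) =
  Ascending-++-∷⁺ _ _ (Ascending-gapPiece f _ x) lo<x x≤B (Ascending-join-gapPieces f s asc)

∈-join-gapPieces : ∀ {B lo f p} s → Ascending B lo s → p ∈ f → lo < p → p ≤ lastOr0 s → p ∈ join (gapPieces f lo s) s
∈-join-gapPieces [] [] p∈f lo<p p≤0 = ⊥-elim (<⇒≱ lo<p (≤-trans p≤0 z≤n))
∈-join-gapPieces {lo = lo} {f} {p} (x ∷ s) ((lo<x , _) ∷ asc) p∈f lo<p p≤last with <-cmp p x
... | tri< p<x _ _ = ∈-++⁺ˡ (∈-gapPiece⁺ {f} {lo} {x} lo<p (<⇒≤∸1 p<x) p∈f)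
... | tri≈ _ refl _ = ∈-++⁺ʳ _ (here refl)
... | tri> _ _ x<p with s
...   | []     = ⊥-elim (<⇒≱ x<p p≤last)
...   | y ∷ s′ = ∈-++⁺ʳ _ (there (∈-join-gapPieces (y ∷ s′) asc p∈f x<p p≤last))

∈-concat-gapPieces⁻ : ∀ {f lo q} s → q ∈ concat (gapPieces f lo s) → q ∈ f
∈-concat-gapPieces⁻ {f} {lo} (x ∷ s) q∈ with ∈-++⁻ (gapPiece f lo x) q∈
... | inj₁ q∈piece = proj₂ (∈-gapPiece⁻ {f} {lo} {x} q∈piece)
... | inj₂ q∈rest  = ∈-concat-gapPieces⁻ s q∈rest

gapPieces-unique : ∀ {B lo} f Zs s → length Zs ≡ length s → Ascending B lo (join Zs s) →
  (∀ {p} → p ∈ f → p ≤ lo ⊎ p ∈ join Zs s) → (∀ {q} → q ∈ concat Zs → q ∈ f) → gapPieces f lo s ≡ Zs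
gapPieces-unique f []       []      _   _   _      _       = refl
gapPieces-unique {lo = lo} f (Z ∷ Zs) (x ∷ s) len asc f⊆ Zs⊆f with Ascending-++-∷⁻ Z (join Zs s) asc
... | ascZ , lo<x , _ , ascRest = cong₂ _∷_
  (Ascending-unique (Ascending-gapPiece f lo x) ascZ piece⊆Z Z⊆piece)
  (gapPieces-unique f Zs s (suc-injective len) ascRest f⊆′ (Zs⊆f ∘ ∈-++⁺ʳ Z))
  where
  below-x : ∀ {q} → q ∈ Z → q < x
  below-x q∈ = ≤∸1⇒< (≤-trans (s≤s z≤n) lo<x) (proj₂ (∈-Ascending ascZ q∈))
  piece⊆Z : ∀ {q} → q ∈ gapPiece f lo x → q ∈ Z
  piece⊆Z {q} q∈ with ∈-gapPiece⁻ {f} {lo} {x} q∈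
  ... | (lo<q , q≤) , q∈f with f⊆ q∈f
  ...   | inj₁ q≤lo = ⊥-elim (<⇒≱ lo<q q≤lo)
  ...   | inj₂ q∈join with ∈-++⁻ Z q∈join
  ...     | inj₁ q∈Z = q∈Z
  ...     | inj₂ (here refl) = ⊥-elim (<-irrefl refl (≤∸1⇒< (≤-trans (s≤s z≤n) lo<x) q≤))
  ...     | inj₂ (there q∈J) = ⊥-elim (<-asym (≤∸1⇒< (≤-trans (s≤s z≤n) lo<x) q≤) (proj₁ (∈-Ascending ascRest q∈J)))
  Z⊆piece : ∀ {q} → q ∈ Z → q ∈ gapPiece f lo x
  Z⊆piece q∈ = ∈-gapPiece⁺ {f} {lo} {x} (proj₁ (∈-Ascending ascZ q∈)) (proj₂ (∈-Ascending ascZ q∈)) (Zs⊆f (∈-++⁺ˡ q∈))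
  f⊆′ : ∀ {p} → p ∈ f → p ≤ x ⊎ p ∈ join Zs s
  f⊆′ p∈ with f⊆ p∈
  ... | inj₁ p≤lo = inj₁ (≤-trans p≤lo (<⇒≤ lo<x))
  ... | inj₂ p∈join with ∈-++⁻ Z p∈join
  ...   | inj₁ p∈Z          = inj₁ (<⇒≤ (below-x p∈Z))
  ...   | inj₂ (here refl)  = inj₁ ≤-refl
  ...   | inj₂ (there p∈J)  = inj₂ p∈J

-- Pigeonhole: the j-th gap piece lies in the image of f beyond position b_{j-1}.
gapPieces-bounded : ∀ {B lo} f a β s → Ascending B lo s → length s ≡ length β → All (_≤ lo) (take a f) →
  length f ≡ a + sum β → T (filtered (prefixSums a β) s f) → Pointwise _≤_ (map length (gapPieces f lo s)) (suffixSums β)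
gapPieces-bounded f a []      []      _                len _     _     _    = []
gapPieces-bounded {lo = lo} f a (b ∷ β) (x ∷ s) ((lo<x , _) ∷ asc) len take≤lo len-f filt =
  piece≤ ∷ gapPieces-bounded f (a + b) β s asc (suc-injective len) take≤x (trans len-f (sym (+-assoc a b (sum β)))) (proj₂ filt′)
  where
  filt′ = Equivalence.to T-∧ filt
  take≤x : All (_≤ x) (take (a + b) f)
  take≤x = All.map (≤ᵇ⇒≤ _ x) (all⁺ _ (take (a + b) f) (proj₁ filt′))
  piece⊆drop : ∀ {z} → z ∈ gapPiece f lo x → z ∈ drop a f
  piece⊆drop z∈ with ∈-gapPiece⁻ {f} {lo} {x} z∈
  ... | (lo<z , _) , z∈f with ∈-++⁻ (take a f) (subst (_ ∈_) (sym (take++drop≡id a f)) z∈f)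
  ...   | inj₁ z∈take = ⊥-elim (<⇒≱ lo<z (All.lookup take≤lo z∈take))
  ...   | inj₂ z∈drop = z∈drop
  piece≤ : length (gapPiece f lo x) ≤ b + sum β
  piece≤ = ≤-trans (length-≤-⊆ (drop a f) (Ascending-gapPiece f lo x) piece⊆drop)
                   (≤-reflexive (trans (List.length-drop a f) (trans (cong (_∸ a) len-f) (m+n∸m≡n a _))))

filtered⇒≤last : ∀ f a b β x s → length s ≡ length β → length f ≡ a + sum (b ∷ β) →
  T (filtered (prefixSums a (b ∷ β)) (x ∷ s) f) → All (_≤ lastOr0 (x ∷ s)) f
filtered⇒≤last f a b []       x []      _   len-f filt =
  subst (All (_≤ x)) (take-all (a + b) f (≤-reflexive (trans len-f (cong (a +_) (+-identityʳ b)))))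
    (All.map (≤ᵇ⇒≤ _ x) (all⁺ _ _ (proj₁ (Equivalence.to T-∧ filt))))
filtered⇒≤last f a b (b′ ∷ β) x (y ∷ s) len len-f filt =
  filtered⇒≤last f (a + b) b′ β y s (suc-injective len) (trans len-f (sym (+-assoc a b _)))
    (proj₂ (Equivalence.to (T-∧ {all (λ v → v ≤ᵇ x) (take (a + b) f)}) filt))

filtered-image⊆join : ∀ {B} β s f → Ascending B 0 s → length s ≡ length β → All (InRange B) f →
  length f ≡ lastOr0 (prefixSums 0 β) → T (filtered (prefixSums 0 β) s f) → ∀ {p} → p ∈ f → p ∈ join (gapPieces f 0 s) s
filtered-image⊆join []      []      []      _   _   _       _     _    ()
filtered-image⊆join (b ∷ β) (x ∷ s) f       asc len inRange len-f filt p∈f =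
  ∈-join-gapPieces (x ∷ s) asc p∈f (proj₁ (All.lookup inRange p∈f))
    (All.lookup (filtered⇒≤last f 0 b β x s (suc-injective len) (trans len-f (lastOr0-prefixSums 0 b β)) filt) p∈f)

-- Filtered maps correspond to pointed maps on the merged image

module WeightExpansion {B : ℕ} (β s : List ℕ) (asc : Ascending B 0 s) (len : length s ≡ length β) where

  bs : List ℕ
  bs = prefixSums 0 β

  Triple : Set
  Triple = List ℕ × List ℕ × List ℕ

  codomain : List ℕ → List (List ℕ)
  codomain I = allMaps (lastOr0 bs) (lastOr0 (canonNs I))

  pairs : List ℕ → List (List ℕ × List ℕ)
  pairs I = concatMap (λ t → map (t ,_) (codomain I)) (incSeqs B (width I))

  triples : List Triple
  triples = concatMap (λ I → map (I ,_) (pairs I)) (indexSet β)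

  _≟³_ : DecidableEquality Triple
  _≟³_ = _≟ᴸ_ ≟× (_≟ᴸ_ ≟× _≟ᴸ_)

  w : List ℕ → ℕ
  w f = 𝟙 (filtered bs s f)

  v : Triple → ℕ
  v (I , t , g) = δ _≟ᴸ_ (select I t) s * 𝟙 (pointed β I g)

  toTriple : List ℕ → Triple
  toTriple f = map length (gapPieces f 0 s) , join (gapPieces f 0 s) s , map (rank (join (gapPieces f 0 s) s)) f

  fromTriple : Triple → List ℕ
  fromTriple (I , t , g) = map (nth t) g

  ∈-triples⁻ : ∀ {I t g} → (I , t , g) ∈ triples → I ∈ indexSet β × t ∈ incSeqs B (width I) × g ∈ codomain I
  ∈-triples⁻ tr∈ with ∈-concatMap-map⁻ pairs (indexSet β) tr∈
  ... | I , tg , I∈ , tg∈ , refl with ∈-concatMap-map⁻ (λ _ → codomain I) (incSeqs B (width I)) tg∈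
  ...   | t , g , t∈ , g∈ , refl = I∈ , t∈ , g∈

  occurrences-triples : ∀ I t g → occurrences _≟³_ triples (I , t , g)
    ≡ occurrences _≟ᴸ_ (indexSet β) I * (occurrences _≟ᴸ_ (incSeqs B (width I)) t * occurrences _≟ᴸ_ (codomain I) g)
  occurrences-triples I t g =
    trans (occurrences-concatMap-map _≟ᴸ_ (_≟ᴸ_ ≟× _≟ᴸ_) _≟³_ (δ-, _≟ᴸ_ (_≟ᴸ_ ≟× _≟ᴸ_)) pairs (indexSet β) I (t , g))
          (cong (occurrences _≟ᴸ_ (indexSet β) I *_)
                (occurrences-concatMap-map _≟ᴸ_ _≟ᴸ_ (_≟ᴸ_ ≟× _≟ᴸ_) (δ-, _≟ᴸ_ _≟ᴸ_) (λ _ → codomain I) (incSeqs B (width I)) t g))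

  ∑-triples : ∑ triples v ≡ ∑[ I ← indexSet β ] (c β I * selectFibre B I s)
  ∑-triples = trans (∑-concatMap _ (indexSet β) v) (∑-cong (indexSet β) (λ I I∈ → begin
    ∑ (map (I ,_) (pairs I)) v
      ≡⟨ trans (∑-map _ (pairs I) v) (∑-concatMap _ (incSeqs B (width I)) _) ⟩
    ∑[ t ← incSeqs B (width I) ] ∑ (map (t ,_) (codomain I)) (λ tg → v (I , tg))
      ≡⟨ ∑-cong (incSeqs B (width I)) (λ t _ →
           trans (∑-map _ (codomain I) _) (∑-*ˡ (codomain I) (δ _≟ᴸ_ (select I t) s) (𝟙 ∘ pointed β I))) ⟩
    ∑[ t ← incSeqs B (width I) ] (δ _≟ᴸ_ (select I t) s * pointedCount β I)
      ≡⟨ ∑-*ʳ (incSeqs B (width I)) (pointedCount β I) _ ⟩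
    selectFibre B I s * pointedCount β I
      ≡⟨ trans (*-comm _ (pointedCount β I)) (cong (_* selectFibre B I s) (sym (c≡pointedCount β I∈))) ⟩
    c β I * selectFibre B I s ∎))
    where open ≡-Reasoning

  module FromFiltered {f} (f∈ : f ∈ allMaps (lastOr0 bs) B) (filt : T (filtered bs s f)) where

    Zs : List (List ℕ)
    Zs = gapPieces f 0 s
    I : List ℕ
    I = map length Zs
    t : List ℕ
    t = join Zs s
    g : List ℕ
    g = map (rank t) f

    len-f : length f ≡ lastOr0 bs
    len-f = proj₂ (∈-allMaps⁻ {lastOr0 bs} f∈)
    len-Zs : length Zs ≡ length s
    len-Zs = length-gapPieces f 0 s
    len-t : length t ≡ width I
    len-t = length-join Zs s len-Zs
    ascT : Ascending B 0 t
    ascT = Ascending-join-gapPieces f s asc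
    f⊆t : ∀ {p} → p ∈ f → p ∈ t
    f⊆t = filtered-image⊆join β s f asc len (proj₁ (∈-allMaps⁻ {lastOr0 bs} f∈)) len-f filt

    g-inRange : All (InRange (length t)) g
    g-inRange = map⁺ (All.tabulate (λ p∈ → proj₂ (nth-rank (f⊆t p∈))))

    nth∘rank : map (nth t) g ≡ f
    nth∘rank = trans (sym (map-∘ f)) (List.map-id-local (All.tabulate (λ p∈ → proj₁ (nth-rank (f⊆t p∈)))))

    occurs : occurrences _≟³_ triples (I , t , g) ≡ 1
    occurs = trans (occurrences-triples I t g) (cong₂ _*_
      (occurrences-boundedSeqs (gapPieces-bounded f 0 β s asc len [] (trans len-f (lastOr0-prefixSums0 β)) filt))
      (cong₂ _*_ (occurrences-incSeqsFrom ascT len-t)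
                 (occurrences-allMaps (subst (λ n → All (InRange n) g) (trans len-t (sym (lastOr0-canonNs I))) g-inRange)
                                      (trans (length-map _ f) len-f))))

    filtered-g : T (filtered bs (canonNs I) g)
    filtered-g = subst T (begin
      filtered bs s f                                          ≡⟨ cong₂ (filtered bs) (trans (nth-canonNs 0 I t) (select-join Zs s len-Zs)) nth∘rank ⟨
      filtered bs (map (nth t) (canonNs I)) (map (nth t) g)    ≡⟨ filtered-relabel bs (canonNs I) g ascT canonNs-inRange g-inRange ⟩
      filtered bs (canonNs I) g                                ∎) filt
      where
      open ≡-Reasoning
      canonNs-inRange : All (InRange (length t)) (canonNs I)
      canonNs-inRange = subst (λ n → All (InRange n) (canonNs I)) (sym len-t) (canonNs-InRange I)

    gaps-in-image : ∀ {m} → m ∈ concat (canonGaps 0 I) → m ∈ g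
    gaps-in-image {m} m∈ = subst (_∈ g) (rank-nth ascT m-inRange) (∈-map⁺ (rank t) (∈-concat-gapPieces⁻ s nth-m∈))
      where
      m-inRange : InRange (length t) m
      m-inRange = proj₁ (∈-canonGaps⁻ 0 I m∈) , ≤-trans (proj₂ (∈-canonGaps⁻ 0 I m∈)) (≤-reflexive (sym len-t))
      nth-m∈ : nth t m ∈ concat Zs
      nth-m∈ = subst (nth t m ∈_) (nth-canonGaps 0 Zs s len-Zs) (∈-map⁺ (λ m → nth t (m ∸ 0)) m∈)

    pointed-g : T (pointed β I g)
    pointed-g = Equivalence.from T-∧ (filtered-g , subst T (sym (imageOK-canonNs I g))
      (all⁻ _ (All.tabulate (λ m∈ → Equivalence.from T-∨ (inj₁ (∈⇒memᵇ (gaps-in-image m∈)))))))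

    weights : v (I , t , g) ≡ w f
    weights = trans (cong₂ _*_ (trans (cong (λ z → δ _≟ᴸ_ z s) (select-join Zs s len-Zs)) (δ-refl _≟ᴸ_ s)) (𝟙-T pointed-g))
                    (sym (𝟙-T filt))

  module FromPointed {I t g} (tr∈ : (I , t , g) ∈ triples) (sel : select I t ≡ s) (pt : T (pointed β I g)) where

    f : List ℕ
    f = map (nth t) g

    ascT : Ascending B 0 t
    ascT = proj₁ (∈-incSeqsFrom⁻ {k = width I} (proj₁ (proj₂ (∈-triples⁻ tr∈))))
    len-t : length t ≡ width I
    len-t = proj₂ (∈-incSeqsFrom⁻ {k = width I} (proj₁ (proj₂ (∈-triples⁻ tr∈))))
    g-inRange : All (InRange (length t)) g
    g-inRange = subst (λ n → All (InRange n) g) (trans (lastOr0-canonNs I) (sym len-t))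
                      (proj₁ (∈-allMaps⁻ {lastOr0 bs} (proj₂ (proj₂ (∈-triples⁻ tr∈)))))
    len-g : length g ≡ lastOr0 bs
    len-g = proj₂ (∈-allMaps⁻ {lastOr0 bs} (proj₂ (proj₂ (∈-triples⁻ tr∈))))

    occurs : occurrences _≟ᴸ_ (allMaps (lastOr0 bs) B) f ≡ 1
    occurs = occurrences-allMaps (map⁺ (All.map (λ m∈ → ∈-Ascending ascT (∈-nth m∈)) g-inRange)) (trans (length-map _ g) len-g)

    filtered-f : T (filtered bs s f)
    filtered-f = subst T (begin
      filtered bs (canonNs I) g                               ≡⟨ filtered-relabel bs (canonNs I) g ascT canonNs-inRange g-inRange ⟨
      filtered bs (map (nth t) (canonNs I)) (map (nth t) g)   ≡⟨ cong (λ ns → filtered bs ns f) (trans (nth-canonNs 0 I t) sel) ⟩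
      filtered bs s f                                         ∎) (proj₁ (Equivalence.to T-∧ pt))
      where
      open ≡-Reasoning
      canonNs-inRange : All (InRange (length t)) (canonNs I)
      canonNs-inRange = subst (λ n → All (InRange n) (canonNs I)) (sym len-t) (canonNs-InRange I)

    Zs : List (List ℕ)
    Zs = pieces I t
    len-Zs : length Zs ≡ length s
    len-Zs = trans (length-pieces I t) (trans (sym (length-select I t)) (cong length sel))
    lengths-Zs : map length Zs ≡ I
    lengths-Zs = map-length-pieces I t len-t
    join≡t : join Zs s ≡ t
    join≡t = trans (cong (join Zs) (sym sel)) (join-pieces I t len-t)

    f⊆join : ∀ {p} → p ∈ f → p ≤ 0 ⊎ p ∈ join Zs s
    f⊆join p∈ with ∈-map⁻ (nth t) p∈
    ... | m , m∈ , refl = inj₂ (subst (nth t m ∈_) (sym join≡t) (∈-nth (All.lookup g-inRange m∈)))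

    -- Every gap position is hit by g: the canonical positions of s are excluded by disjointness.
    Zs⊆f : ∀ {q} → q ∈ concat Zs → q ∈ f
    Zs⊆f q∈ with ∈-map⁻ _ (subst (_ ∈_) (sym (nth-canonGaps 0 Zs s len-Zs)) q∈)
    ... | m , m∈ , refl with Equivalence.to T-∨ (All.lookup image-g m∈I)
      where
      m∈I : m ∈ concat (canonGaps 0 I)
      m∈I = subst (λ J → m ∈ concat (canonGaps 0 J)) lengths-Zs m∈
      image-g : All (T ∘ inImage (canonNs I) g) (concat (canonGaps 0 I))
      image-g = all⁺ _ _ (subst T (imageOK-canonNs I g) (proj₂ (Equivalence.to T-∧ pt)))
    ...   | inj₁ m∈g  = subst (_∈ f) (cong (λ u → nth u m) (sym join≡t)) (∈-map⁺ (nth t) (memᵇ⇒∈ m∈g))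
    ...   | inj₂ m∈ns = ⊥-elim (canonNs-disjoint 0 I (memᵇ⇒∈ m∈ns) (subst (λ J → m ∈ concat (canonGaps 0 J)) lengths-Zs m∈))

    gapPieces≡ : gapPieces f 0 s ≡ Zs
    gapPieces≡ = gapPieces-unique f Zs s len-Zs (subst (Ascending B 0) (sym join≡t) ascT) f⊆join Zs⊆f

    toTriple≡ : toTriple f ≡ (I , t , g)
    toTriple≡ = cong₂ _,_ (trans (cong (map length) gapPieces≡) lengths-Zs) (cong₂ _,_ join≡
      (trans (cong (λ u → map (rank u) f) join≡)
        (trans (sym (map-∘ g)) (List.map-id-local (All.map (rank-nth ascT) g-inRange)))))
      where
      join≡ : join (gapPieces f 0 s) s ≡ t
      join≡ = trans (cong (λ Z → join Z s) gapPieces≡) join≡t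

    weights : w f ≡ v (I , t , g)
    weights = trans (𝟙-T filtered-f) (sym (cong₂ _*_ (trans (cong (λ z → δ _≟ᴸ_ z s) sel) (δ-refl _≟ᴸ_ s)) (𝟙-T pt)))

  weight-expansion : weight s β ≡ ∑[ I ← indexSet β ] (c β I * selectFibre B I s)
  weight-expansion = begin
    weight s β                            ≡⟨ weight≡count-filtered β s asc len ⟩
    ∑ (allMaps (lastOr0 bs) B) w          ≡⟨ ∑-bijection _≟ᴸ_ _≟³_ (allMaps (lastOr0 bs) B) triples w v toTriple fromTriple to from ⟩
    ∑ triples v                           ≡⟨ ∑-triples ⟩
    ∑[ I ← indexSet β ] (c β I * selectFibre B I s) ∎
    where
    open ≡-Reasoning
    to : ∀ f → f ∈ allMaps (lastOr0 bs) B → w f ≢ 0 →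
      occurrences _≟³_ triples (toTriple f) ≡ 1 × fromTriple (toTriple f) ≡ f × v (toTriple f) ≡ w f
    to f f∈ w≢0 = occurs , nth∘rank , weights
      where open FromFiltered f∈ (𝟙≢0⇒T w≢0)
    from : ∀ y → y ∈ triples → v y ≢ 0 →
      occurrences _≟ᴸ_ (allMaps (lastOr0 bs) B) (fromTriple y) ≡ 1 × toTriple (fromTriple y) ≡ y × w (fromTriple y) ≡ v y
    from (I , t , g) tr∈ v≢0 = occurs , toTriple≡ , weights
      where
      δ≢0 : δ _≟ᴸ_ (select I t) s ≢ 0
      δ≢0 δ≡0 = v≢0 (cong (_* 𝟙 (pointed β I g)) δ≡0)
      𝟙≢0 : 𝟙 (pointed β I g) ≢ 0
      𝟙≢0 𝟙≡0 = v≢0 (trans (cong (δ _≟ᴸ_ (select I t) s *_) 𝟙≡0) (*-zeroʳ (δ _≟ᴸ_ (select I t) s)))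
      open FromPointed tr∈ (δ≢0⇒≡ _≟ᴸ_ δ≢0) (𝟙≢0⇒T 𝟙≢0)

-- The hypothesis that α ends with a positive entry is not needed for the identity.
proposition5p4 : (α β : List ℕ) → length α ≡ length β → LastPositive α →
    (e : List ℕ) →
    coeffMhat α β e ≡ sum (map (λ I → c β I * coeffM (padded I α) e) (indexSet β))
proposition5p4 α β len _ e = coeffMhat-reduction α β e len (λ s s∈ →
  let asc , len-s = ∈-incSeqsFrom⁻ {k = length α} s∈ in WeightExpansion.weight-expansion β s asc (trans len-s len))
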